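{- Let $L$ be a finite graded lattice which is isomorphic to the core of some upho lattice. Then for every integer $m\ge1$, all coefficients of the formal power series $\chi^*(L;x^m)/\chi^*(L;x)^m$ are nonnegative.
   Context: For a finite graded lattice $L$ with rank function $\rho$ and Möbius function $\mu$, $\chi^*(L;x)=\sum_{p\in L}\mu(\hat0,p)x^{\rho(p)}$. A poset $\mathcal{P}$ is finite type $\mathbb{N}$-graded if it has a minimum $\hat0$, a rank function $\rho$ with $\rho(\hat0)=0$ such that every maximal chain has the form $\hat0=x_0\lessdot x_1\lessdot\cdots$ with $\rho(x_i)=i$, and finitely many elements of each rank. An upho lattice is a finite type $\mathbb{N}$-graded lattice $\mathcal{L}$ with at least two elements such that every principal filter $\{q\ge p\}$ is isomorphic to $\mathcal{L}$. Its core is $[\hat0,s_1\vee\cdots\vee s_r]$ with $s_i$ the atoms of $\mathcal{L}$. -}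

module Defs where

open import Level using (0ℓ)
open import Data.Nat using (ℕ; zero; suc; _∸_; _<_)
open import Data.Nat.Properties using ()
open import Data.Fin using (Fin; _≟_)
open import Data.Integer using (ℤ; 0ℤ; 1ℤ; -_) renaming (_+_ to _+ℤ_; _*_ to _*ℤ_)
open import Data.List using (List; []; _∷_; map; foldr; filter; upTo; zipWith; length; _++_)
open import Data.List.Membership.Propositional using (_∈_)
open import Data.List.Base using (allFin)
open import Data.Sum using (_⊎_)
open import Data.Product using (Σ; _×_; _,_; proj₁; proj₂)
open import Relation.Nullary using (¬_; Dec; yes; no; ¬?)
open import Relation.Nullary.Decidable using (_×-dec_)
open import Relation.Binary.Core using (Rel)
open import Relation.Binary.Definitions using (Minimum; Decidable)
open import Relation.Binary.PropositionalEquality using (_≡_)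
open import Relation.Binary.Lattice.Structures using (IsLattice)

module _ {A : Set} (_≤_ : Rel A 0ℓ) where

  Lt : A → A → Set
  Lt x y = (x ≤ y) × ¬ (x ≡ y)

  Covers : A → A → Set
  Covers x y = Lt x y × (∀ z → x ≤ z → z ≤ y → (z ≡ x) ⊎ (z ≡ y))

record UphoLattice : Set₁ where
  field
    P        : Set
    _≤_      : Rel P 0ℓ
    _∨_      : P → P → P
    _∧_      : P → P → P
    isLattice : IsLattice _≡_ _≤_ _∨_ _∧_
    bot      : P
    bot-min  : Minimum _≤_ bot
    nontrivial : Σ P (λ x → ¬ (x ≡ bot))
    -- rank function; "finite type ℕ-graded":
    -- ρ(0̂) = 0, covers raise the rank by one, strict comparabilities
    -- raise the rank (together: every maximal chain is
    -- 0̂ = x₀ ⋖ x₁ ⋖ ⋯ with ρ(xᵢ) = i), and finitely many elements of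
    -- each rank (given by an enumeration of each rank level).
    ρ        : P → ℕ
    ρ-bot    : ρ bot ≡ 0
    ρ-cover  : ∀ x y → Covers _≤_ x y → ρ y ≡ suc (ρ x)
    ρ-strict : ∀ x y → Lt _≤_ x y → ρ x < ρ y
    rankLevel          : ℕ → List P
    rankLevel-complete : ∀ x → x ∈ rankLevel (ρ x)
    rankLevel-sound    : ∀ k x → x ∈ rankLevel k → ρ x ≡ k
    -- every principal filter {q ≥ p} is isomorphic (as a poset) to P
    filterIso     : (p : P) → Σ P (λ q → p ≤ q) → P
    filterIso⁻¹   : (p : P) → P → Σ P (λ q → p ≤ q)
    filterIso-inv₁ : ∀ p x → filterIso p (filterIso⁻¹ p x) ≡ x
    filterIso-inv₂ : ∀ p u → proj₁ (filterIso⁻¹ p (filterIso p u)) ≡ proj₁ u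
    filterIso-mono : ∀ p u v → proj₁ u ≤ proj₁ v → filterIso p u ≤ filterIso p v
    filterIso-refl : ∀ p u v → filterIso p u ≤ filterIso p v → proj₁ u ≤ proj₁ v

  atoms : List P
  atoms = rankLevel 1

  coreTop : P
  coreTop = foldr _∨_ bot atoms

  -- the core [0̂, s₁ ∨ ⋯ ∨ s_r] (every element is ≥ 0̂)
  Core : Set
  Core = Σ P (λ q → q ≤ coreTop)

record FiniteGradedLattice : Set₁ where
  field
    n        : ℕ
    _≤_      : Rel (Fin n) 0ℓ
    _≤?_     : Decidable _≤_
    _∨_      : Fin n → Fin n → Fin n
    _∧_      : Fin n → Fin n → Fin n
    isLattice : IsLattice _≡_ _≤_ _∨_ _∧_
    bot      : Fin n
    bot-min  : Minimum _≤_ bot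
    ρ        : Fin n → ℕ
    ρ-bot    : ρ bot ≡ 0
    ρ-cover  : ∀ x y → Covers _≤_ x y → ρ y ≡ suc (ρ x)

  _<?_ : (x y : Fin n) → Dec (Lt _≤_ x y)
  x <? y = (x ≤? y) ×-dec ¬? (x ≟ y)

  -- μ(0̂, p) with fuel: μ(0̂,0̂) = 1, μ(0̂,p) = - Σ_{0̂ ≤ q < p} μ(0̂,q).
  -- Fuel n (number of elements) suffices since chains have < n steps.
  mobiusFuel : ℕ → Fin n → ℤ
  mobiusFuel zero p = 0ℤ
  mobiusFuel (suc k) p with p ≟ bot
  ... | yes _ = 1ℤ
  ... | no _ = - foldr _+ℤ_ 0ℤ (map (mobiusFuel k) (filter (λ q → q <? p) (allFin n)))

  mobius : Fin n → ℤ
  mobius p = mobiusFuel n p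

  chiStar : ℕ → ℤ
  chiStar k = foldr _+ℤ_ 0ℤ (map mobius (filter (λ p → ρ p Data.Nat.≟ k) (allFin n)))

record CoreIso (L : FiniteGradedLattice) (U : UphoLattice) : Set where
  module L = FiniteGradedLattice L
  module U = UphoLattice U
  field
    to       : Fin L.n → U.Core
    from     : U.Core → Fin L.n
    from-to  : ∀ x → from (to x) ≡ x
    to-from  : ∀ c → proj₁ (to (from c)) ≡ proj₁ c
    to-mono  : ∀ x y → x L.≤ y → proj₁ (to x) U.≤ proj₁ (to y)
    to-refl  : ∀ x y → proj₁ (to x) U.≤ proj₁ (to y) → x L.≤ y

Series : Set
Series = ℕ → ℤ

sumℤ : List ℤ → ℤ
sumℤ = foldr _+ℤ_ 0ℤ

_⊛_ : Series → Series → Series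
(a ⊛ b) k = sumℤ (map (λ i → a i *ℤ b (k ∸ i)) (upTo (suc k)))

one : Series
one zero = 1ℤ
one (suc _) = 0ℤ

_^ˢ_ : Series → ℕ → Series
a ^ˢ zero = one
a ^ˢ suc m = a ⊛ (a ^ˢ m)

-- a(x^m): coefficient of x^k is a(j) if k = j·m, else 0  (for m ≥ 1, j ≤ k)
substPow : Series → ℕ → Series
substPow a m k = sumℤ (map (λ j → if' (j Data.Nat.* m Data.Nat.≟ k) (a j)) (upTo (suc k)))
  where
  if' : ∀ {A : Set} → Dec A → ℤ → ℤ
  if' (yes _) z = z
  if' (no _) _ = 0ℤ

-- Quotient a/b of power series, for b with constant term 1:
-- q(k) = a(k) - Σ_{i<k} b(k-i) q(i).  divPrefix k = [q 0, …, q (k-1)].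
divPrefix : Series → Series → ℕ → List ℤ
divPrefix a b zero = []
divPrefix a b (suc k) =
  divPrefix a b k ++
  (a k +ℤ (- sumℤ (zipWith (λ i qi → b (k ∸ i) *ℤ qi) (upTo k) (divPrefix a b k)))) ∷ []

divSeries : Series → Series → Series
divSeries a b k = lastOr (divPrefix a b (suc k))
  where
  lastOr : List ℤ → ℤ
  lastOr [] = 0ℤ
  lastOr (x ∷ []) = x
  lastOr (_ ∷ y ∷ ys) = lastOr (y ∷ ys)

{-# OPTIONS --safe #-}
module Submission where

-- Let F be the rank generating function of the upho lattice U, and identify L
-- with the core of U. For q ∈ U, the p ∈ L below q are those below q ∧ (s₁ ∨ ⋯ ∨ s_r),
-- and that meet is 0̂ only for q = 0̂ (any other q lies above an atom); so
-- ∑_{p ∈ L, p ≤ q} μ(0̂,p) = [q = 0̂]. Since the filter above p is a copy of U,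
-- ∑_{q ≥ p} x^ρ(q) = x^ρ(p) F(x), and summing against μ gives χ*(L;x) F(x) = 1.
-- Therefore χ*(L;x^m)/χ*(L;x)^m = χ*(L;x^m) F(x)^m = ∑_p μ(0̂,p) (∑_{q ≥ p} x^ρ(q))^m
-- = ∑_{q₁,…,q_m} [q₁ ∧ ⋯ ∧ q_m = 0̂] x^(ρ(q₁)+⋯+ρ(q_m)), whose coefficients are
-- counts. The coefficient of x^k only involves elements of rank ≤ k, so the
-- argument runs in that finite set.

open import Defs
open import Data.Nat using (ℕ; _≥_)
open import Data.Integer using (+_) renaming (_≤_ to _≤ℤ_)

open import Level using (0ℓ)
open import Data.Nat as ℕ using (zero; suc; _∸_; z≤n; s≤s)
import Data.Nat.Properties as ℕₚ
open import Data.Integer as ℤ using (ℤ; 0ℤ; 1ℤ; -_; _+_; _*_)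
import Data.Integer.Properties as ℤₚ
open import Data.Integer.Tactic.RingSolver using (solve-∀)
open import Data.Fin as Fin using (Fin)
open import Data.List
  using (List; []; _∷_; _++_; _∷ʳ_; map; concatMap; filter; foldr; length; lookup; zipWith;
         upTo; applyUpTo; allFin)
import Data.List.Properties as Listₚ
open import Data.List.Extrema.Nat using (argmax; argmax-all; f[xs]≤f[argmax])
open import Data.List.Membership.Propositional using (_∈_; _∉_)
open import Data.List.Membership.Propositional.Properties
  using (∈-allFin; ∈-filter⁺; ∈-lookup; ∈-upTo⁺; ∈-upTo⁻; ∈-concat⁺′; ∈-concat⁻′; ∈-map⁺; ∈-map⁻)
open import Data.List.Relation.Unary.Any as Any using (here; there)
open import Data.List.Relation.Unary.Any.Properties using (lookup-index)
open import Data.List.Relation.Unary.All as All using (All; []; _∷_)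
open import Data.List.Relation.Unary.All.Properties using (all-filter)
open import Data.List.Relation.Unary.AllPairs using ([]; _∷_)
open import Data.List.Relation.Unary.Unique.Propositional using (Unique)
open import Data.List.Relation.Unary.Unique.Propositional.Properties using (upTo⁺; allFin⁺)
open import Data.Vec as Vec using (Vec; []; _∷_)
open import Data.Product using (Σ; _×_; _,_; proj₁; proj₂)
open import Data.Sum using (_⊎_; inj₁; inj₂)
open import Data.Unit using (⊤; tt)
open import Data.Empty using (⊥-elim)
open import Relation.Nullary using (Dec; yes; no; ¬_)
open import Relation.Nullary.Decidable using (_×-dec_; decidable-stable; ¬¬-excluded-middle)
open import Relation.Nullary.Negation using (¬¬-Monad)
open import Relation.Unary using (Decidable)
open import Relation.Binary.Bundles using (Setoid)
open import Relation.Binary.Definitions using (DecidableEquality)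
open import Relation.Binary.Lattice.Structures using (IsLattice)
open import Relation.Binary.PropositionalEquality
import Relation.Binary.Reasoning.Setoid as SetoidReasoning
import Algebra.Properties.CommutativeSemigroup as CommutativeSemigroupProperties

private
  module +-CS = CommutativeSemigroupProperties ℤₚ.+-commutativeSemigroup
  module *-CS = CommutativeSemigroupProperties ℤₚ.*-commutativeSemigroup

  variable
    A B : Set
    Q R : Set
    m : ℕ

-- Iverson brackets and finite sums over lists

when : Dec Q → ℤ → ℤ
when (yes _) z = z
when (no _) _ = 0ℤ

when-yes : (d : Dec Q) {z : ℤ} → Q → when d z ≡ z
when-yes (yes _) _ = refl
when-yes (no ¬p) p = ⊥-elim (¬p p)

when-no : (d : Dec Q) {z : ℤ} → ¬ Q → when d z ≡ 0ℤ
when-no (yes p) ¬p = ⊥-elim (¬p p)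
when-no (no _) _ = refl

when-cong : (d : Dec Q) (e : Dec R) {z w : ℤ} → (Q → R) → (R → Q) → (Q → z ≡ w) → when d z ≡ when e w
when-cong (yes p) (yes _) _ _ z≡w = z≡w p
when-cong (yes p) (no ¬q) p→q _ _ = ⊥-elim (¬q (p→q p))
when-cong (no ¬p) (yes q) _ q→p _ = ⊥-elim (¬p (q→p q))
when-cong (no _) (no _) _ _ _ = refl

when-congʳ : (d : Dec Q) {z w : ℤ} → (Q → z ≡ w) → when d z ≡ when d w
when-congʳ d = when-cong d d (λ q → q) (λ q → q)

when-*ˡ : (d : Dec Q) (w z : ℤ) → w * when d z ≡ when d (w * z)
when-*ˡ (yes _) w z = refl
when-*ˡ (no _) w z = ℤₚ.*-zeroʳ w

when-*ʳ : (d : Dec Q) (z w : ℤ) → when d z * w ≡ when d (z * w)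
when-*ʳ (yes _) z w = refl
when-*ʳ (no _) z w = refl

when1-* : (d : Dec Q) (z : ℤ) → when d 1ℤ * z ≡ when d z
when1-* (yes _) z = ℤₚ.*-identityˡ z
when1-* (no _) z = refl

*-when1 : (d : Dec Q) (z : ℤ) → z * when d 1ℤ ≡ when d z
*-when1 d z = trans (when-*ˡ d z 1ℤ) (cong (when d) (ℤₚ.*-identityʳ z))

when-×-dec : (d : Dec Q) (e : Dec R) (z : ℤ) → when d (when e z) ≡ when (d ×-dec e) z
when-×-dec (yes _) (yes _) z = refl
when-×-dec (yes _) (no _) z = refl
when-×-dec (no _) _ z = refl

when-comm : (d : Dec Q) (e : Dec R) (z : ℤ) → when d (when e z) ≡ when e (when d z)
when-comm (yes _) (yes _) z = refl
when-comm (yes _) (no _) z = refl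
when-comm (no _) (yes _) z = refl
when-comm (no _) (no _) z = refl

when-nonneg : (d : Dec Q) {z : ℤ} → + 0 ≤ℤ z → + 0 ≤ℤ when d z
when-nonneg (yes _) 0≤z = 0≤z
when-nonneg (no _) _ = ℤ.+≤+ z≤n

∑ : List A → (A → ℤ) → ℤ
∑ xs f = sumℤ (map f xs)

infix 5 ∑
syntax ∑ xs (λ x → e) = ∑[ x ∈ xs ] e

∑-cong-∈ : (xs : List A) {f g : A → ℤ} → (∀ {x} → x ∈ xs → f x ≡ g x) → ∑ xs f ≡ ∑ xs g
∑-cong-∈ [] _ = refl
∑-cong-∈ (x ∷ xs) f≡g = cong₂ _+_ (f≡g (here refl)) (∑-cong-∈ xs (λ x∈ → f≡g (there x∈)))

∑-cong : (xs : List A) {f g : A → ℤ} → (∀ x → f x ≡ g x) → ∑ xs f ≡ ∑ xs g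
∑-cong xs f≡g = ∑-cong-∈ xs (λ {x} _ → f≡g x)

∑-zero : (xs : List A) {f : A → ℤ} → (∀ {x} → x ∈ xs → f x ≡ 0ℤ) → ∑ xs f ≡ 0ℤ
∑-zero [] _ = refl
∑-zero (x ∷ xs) f≡0 = cong₂ _+_ (f≡0 (here refl)) (∑-zero xs (λ x∈ → f≡0 (there x∈)))

∑-+ : (xs : List A) (f g : A → ℤ) → ∑[ x ∈ xs ] (f x + g x) ≡ ∑ xs f + ∑ xs g
∑-+ [] f g = refl
∑-+ (x ∷ xs) f g = begin
  f x + g x + (∑[ y ∈ xs ] (f y + g y)) ≡⟨ cong (_+_ (f x + g x)) (∑-+ xs f g) ⟩
  f x + g x + (∑ xs f + ∑ xs g)        ≡⟨ +-CS.interchange (f x) (g x) (∑ xs f) (∑ xs g) ⟩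
  f x + ∑ xs f + (g x + ∑ xs g)        ∎
  where open ≡-Reasoning

∑-*ˡ : (xs : List A) (c : ℤ) (f : A → ℤ) → c * ∑ xs f ≡ ∑[ x ∈ xs ] (c * f x)
∑-*ˡ [] c f = ℤₚ.*-zeroʳ c
∑-*ˡ (x ∷ xs) c f = trans (ℤₚ.*-distribˡ-+ c (f x) (∑ xs f)) (cong (_+_ (c * f x)) (∑-*ˡ xs c f))

∑-*ʳ : (xs : List A) (c : ℤ) (f : A → ℤ) → ∑ xs f * c ≡ ∑[ x ∈ xs ] (f x * c)
∑-*ʳ xs c f = trans (ℤₚ.*-comm (∑ xs f) c) (trans (∑-*ˡ xs c f) (∑-cong xs (λ x → ℤₚ.*-comm c (f x))))

∑-when : (xs : List A) (d : Dec Q) (f : A → ℤ) → ∑[ x ∈ xs ] when d (f x) ≡ when d (∑ xs f)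
∑-when xs (yes _) f = refl
∑-when xs (no _) f = ∑-zero xs (λ _ → refl)

∑-++ : (xs ys : List A) (f : A → ℤ) → ∑ (xs ++ ys) f ≡ ∑ xs f + ∑ ys f
∑-++ [] ys f = sym (ℤₚ.+-identityˡ _)
∑-++ (x ∷ xs) ys f = trans (cong (_+_ (f x)) (∑-++ xs ys f)) (sym (ℤₚ.+-assoc (f x) (∑ xs f) (∑ ys f)))

∑-map : (g : A → B) (xs : List A) (f : B → ℤ) → ∑ (map g xs) f ≡ ∑[ x ∈ xs ] f (g x)
∑-map g xs f = cong sumℤ (sym (Listₚ.map-∘ xs))

∑-concatMap : (g : A → List B) (xs : List A) (f : B → ℤ) → ∑ (concatMap g xs) f ≡ ∑[ x ∈ xs ] ∑ (g x) f
∑-concatMap g [] f = refl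
∑-concatMap g (x ∷ xs) f = trans (∑-++ (g x) (concatMap g xs) f) (cong (_+_ (∑ (g x) f)) (∑-concatMap g xs f))

∑-filter : {P : A → Set} (P? : Decidable P) (xs : List A) (f : A → ℤ) →
           ∑ (filter P? xs) f ≡ ∑[ x ∈ xs ] when (P? x) (f x)
∑-filter P? [] f = refl
∑-filter P? (x ∷ xs) f with P? x
... | yes _ = cong (_+_ (f x)) (∑-filter P? xs f)
... | no _ = trans (∑-filter P? xs f) (sym (ℤₚ.+-identityˡ _))

∑-nonneg : (xs : List A) (f : A → ℤ) → (∀ x → + 0 ≤ℤ f x) → + 0 ≤ℤ ∑ xs f
∑-nonneg [] f _ = ℤ.+≤+ z≤n
∑-nonneg (x ∷ xs) f 0≤f = ℤₚ.+-mono-≤ (0≤f x) (∑-nonneg xs f 0≤f)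

∑-swap : (xs : List A) (ys : List B) (f : A → B → ℤ) →
         ∑[ x ∈ xs ] ∑[ y ∈ ys ] f x y ≡ ∑[ y ∈ ys ] ∑[ x ∈ xs ] f x y
∑-swap [] ys f = sym (∑-zero ys (λ _ → refl))
∑-swap (x ∷ xs) ys f = trans (cong (_+_ (∑ ys (f x))) (∑-swap xs ys f))
                             (sym (∑-+ ys (f x) (λ y → ∑[ x′ ∈ xs ] f x′ y)))

module _ (_≟_ : DecidableEquality A) where

  ∑-delta-∉ : (xs : List A) (x₀ : A) (f : A → ℤ) → x₀ ∉ xs → ∑[ x ∈ xs ] when (x ≟ x₀) (f x) ≡ 0ℤ
  ∑-delta-∉ xs x₀ f x₀∉ = ∑-zero xs (λ {x} x∈ → when-no (x ≟ x₀) (λ { refl → x₀∉ x∈ }))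

  ∑-delta : (xs : List A) (x₀ : A) (f : A → ℤ) → Unique xs → x₀ ∈ xs →
            ∑[ x ∈ xs ] when (x ≟ x₀) (f x) ≡ f x₀
  ∑-delta (x ∷ xs) x₀ f (x∉ ∷ _) (here refl) =
    trans (cong₂ _+_ (when-yes (x ≟ x) refl) (∑-delta-∉ xs x f (λ x∈ → All.lookup x∉ x∈ refl)))
          (ℤₚ.+-identityʳ _)
  ∑-delta (x ∷ xs) x₀ f (x∉ ∷ xs!) (there x₀∈) =
    trans (cong₂ _+_ (when-no (x ≟ x₀) (λ { refl → All.lookup x∉ x₀∈ refl })) (∑-delta xs x₀ f xs! x₀∈))
          (ℤₚ.+-identityˡ _)

record Correspondence {A B : Set} (xs : List A) (P : A → Set) (ys : List B) (Q : B → Set) : Set where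
  field
    to        : A → B
    from      : B → A
    to-∈      : ∀ {x} → x ∈ xs → P x → to x ∈ ys
    to-Q      : ∀ {x} → x ∈ xs → P x → Q (to x)
    from-∈    : ∀ {y} → y ∈ ys → Q y → from y ∈ xs
    from-P    : ∀ {y} → y ∈ ys → Q y → P (from y)
    from∘to   : ∀ {x} → x ∈ xs → P x → from (to x) ≡ x
    to∘from   : ∀ {y} → y ∈ ys → Q y → to (from y) ≡ y

module _ (_≟A_ : DecidableEquality A) (_≟B_ : DecidableEquality B)
         {xs : List A} {ys : List B} (xs! : Unique xs) (ys! : Unique ys)
         {P : A → Set} {Q : B → Set} (P? : ∀ x → Dec (P x)) (Q? : ∀ y → Dec (Q y))
         (corr : Correspondence xs P ys Q) where

  open Correspondence corr

  ∑-reindex : (f : A → ℤ) (g : B → ℤ) → (∀ {x} → x ∈ xs → P x → f x ≡ g (to x)) →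
              ∑[ x ∈ xs ] when (P? x) (f x) ≡ ∑[ y ∈ ys ] when (Q? y) (g y)
  ∑-reindex f g f≡g∘to = begin
    ∑[ x ∈ xs ] when (P? x) (f x)
      ≡⟨ ∑-cong-∈ xs (λ {x} x∈ → when-congʳ (P? x) (λ px →
           trans (f≡g∘to x∈ px) (sym (∑-delta _≟B_ ys (to x) g ys! (to-∈ x∈ px))))) ⟩
    ∑[ x ∈ xs ] when (P? x) (∑[ y ∈ ys ] when (y ≟B to x) (g y))
      ≡⟨ ∑-cong xs (λ x → sym (∑-when ys (P? x) _)) ⟩
    ∑[ x ∈ xs ] ∑[ y ∈ ys ] when (P? x) (when (y ≟B to x) (g y))
      ≡⟨ ∑-swap xs ys _ ⟩
    ∑[ y ∈ ys ] ∑[ x ∈ xs ] when (P? x) (when (y ≟B to x) (g y))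
      ≡⟨ ∑-cong-∈ ys fibre ⟩
    ∑[ y ∈ ys ] when (Q? y) (g y) ∎
    where
    open ≡-Reasoning
    fibre : ∀ {y} → y ∈ ys → ∑[ x ∈ xs ] when (P? x) (when (y ≟B to x) (g y)) ≡ when (Q? y) (g y)
    fibre {y} y∈ with Q? y
    ... | yes qy = trans (∑-cong-∈ xs term) (∑-delta _≟A_ xs (from y) (λ _ → g y) xs! (from-∈ y∈ qy))
      where
      term : ∀ {x} → x ∈ xs → when (P? x) (when (y ≟B to x) (g y)) ≡ when (x ≟A from y) (g y)
      term {x} x∈ with P? x | y ≟B to x | x ≟A from y
      ... | yes _  | yes _     | yes _    = refl
      ... | yes px | yes y≡to  | no x≢    = ⊥-elim (x≢ (trans (sym (from∘to x∈ px)) (cong from (sym y≡to))))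
      ... | yes _  | no y≢     | yes refl = ⊥-elim (y≢ (sym (to∘from y∈ qy)))
      ... | yes _  | no _      | no _     = refl
      ... | no ¬px | _         | yes refl = ⊥-elim (¬px (from-P y∈ qy))
      ... | no _   | _         | no _     = refl
    ... | no ¬qy = ∑-zero xs term
      where
      term : ∀ {x} → x ∈ xs → when (P? x) (when (y ≟B to x) (g y)) ≡ 0ℤ
      term {x} x∈ with P? x | y ≟B to x
      ... | yes px | yes refl = ⊥-elim (¬qy (to-Q x∈ px))
      ... | yes _  | no _     = refl
      ... | no _   | _        = refl

∑-upTo-suc : (n : ℕ) (f : ℕ → ℤ) → ∑ (upTo (suc n)) f ≡ ∑ (upTo n) f + f n
∑-upTo-suc n f = begin
  ∑ (upTo (suc n)) f          ≡⟨ cong (λ is → ∑ is f) (sym (Listₚ.upTo-∷ʳ n)) ⟩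
  ∑ (upTo n ∷ʳ n) f           ≡⟨ ∑-++ (upTo n) (n ∷ []) f ⟩
  ∑ (upTo n) f + (f n + 0ℤ)   ≡⟨ cong (_+_ (∑ (upTo n) f)) (ℤₚ.+-identityʳ (f n)) ⟩
  ∑ (upTo n) f + f n          ∎
  where open ≡-Reasoning

∑-upTo-extend : ∀ {n n′} (f : ℕ → ℤ) → n ℕ.≤ n′ → (∀ i → n ℕ.≤ i → f i ≡ 0ℤ) →
                ∑ (upTo n′) f ≡ ∑ (upTo n) f
∑-upTo-extend {n} f n≤n′ f≡0 with ℕₚ.m≤n⇒∃[o]m+o≡n n≤n′
... | d , refl = trans (cong (λ l → ∑ (upTo l) f) (ℕₚ.+-comm n d)) (go d)
  where
  go : ∀ d → ∑ (upTo (d ℕ.+ n)) f ≡ ∑ (upTo n) f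
  go zero = refl
  go (suc d) = begin
    ∑ (upTo (suc (d ℕ.+ n))) f             ≡⟨ ∑-upTo-suc (d ℕ.+ n) f ⟩
    ∑ (upTo (d ℕ.+ n)) f + f (d ℕ.+ n)     ≡⟨ cong₂ _+_ (go d) (f≡0 (d ℕ.+ n) (ℕₚ.m≤n+m n d)) ⟩
    ∑ (upTo n) f + 0ℤ                      ≡⟨ ℤₚ.+-identityʳ _ ⟩
    ∑ (upTo n) f                           ∎
    where open ≡-Reasoning

∑-upTo-delta : (n i₀ : ℕ) (f : ℕ → ℤ) → ∑[ i ∈ upTo n ] when (i ℕ.≟ i₀) (f i) ≡ when (i₀ ℕ.<? n) (f i₀)
∑-upTo-delta n i₀ f with i₀ ℕ.<? n
... | yes i₀<n = ∑-delta ℕ._≟_ (upTo n) i₀ f (upTo⁺ n) (∈-upTo⁺ i₀<n)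
... | no i₀≮n = ∑-delta-∉ ℕ._≟_ (upTo n) i₀ f (λ i₀∈ → i₀≮n (∈-upTo⁻ i₀∈))

-- Formal power series

infix 4 _≐_ _≈[_]_
infixr 7 _·ˢ_
infix 25 X^_

_≐_ : Series → Series → Set
a ≐ b = ∀ j → a j ≡ b j

_≈[_]_ : Series → ℕ → Series → Set
a ≈[ K ] b = ∀ j → j ℕ.≤ K → a j ≡ b j

≐⇒≈ : ∀ {a b} K → a ≐ b → a ≈[ K ] b
≐⇒≈ K a≐b j _ = a≐b j

≐-setoid : Setoid _ _
≐-setoid = record
  { Carrier = Series
  ; _≈_ = _≐_
  ; isEquivalence = record
    { refl = λ _ → refl
    ; sym = λ a≐b j → sym (a≐b j)
    ; trans = λ a≐b b≐c j → trans (a≐b j) (b≐c j)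
    }
  }

≈-setoid : ℕ → Setoid _ _
≈-setoid K = record
  { Carrier = Series
  ; _≈_ = _≈[ K ]_
  ; isEquivalence = record
    { refl = λ _ _ → refl
    ; sym = λ a≈b j j≤K → sym (a≈b j j≤K)
    ; trans = λ a≈b b≈c j j≤K → trans (a≈b j j≤K) (b≈c j j≤K)
    }
  }

X^_ : ℕ → Series
(X^ d) j = when (d ℕ.≟ j) 1ℤ

_·ˢ_ : ℤ → Series → Series
(c ·ˢ a) j = c * a j

∑ˢ : List A → (A → Series) → Series
∑ˢ xs f j = ∑[ x ∈ xs ] f x j

infix 5 ∑ˢ
syntax ∑ˢ xs (λ x → e) = ∑ˢ[ x ∈ xs ] e

X^0≐one : X^ 0 ≐ one
X^0≐one zero = refl
X^0≐one (suc j) = refl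

⊛-congˡ : ∀ {a a′} b → a ≐ a′ → a ⊛ b ≐ a′ ⊛ b
⊛-congˡ b a≐a′ k = ∑-cong (upTo (suc k)) (λ i → cong (_* b (k ∸ i)) (a≐a′ i))

⊛-congʳ : ∀ a {b b′} → b ≐ b′ → a ⊛ b ≐ a ⊛ b′
⊛-congʳ a b≐b′ k = ∑-cong (upTo (suc k)) (λ i → cong (a i *_) (b≐b′ (k ∸ i)))

⊛-cong-≈ : ∀ {a a′ b b′} K → a ≈[ K ] a′ → b ≈[ K ] b′ → a ⊛ b ≈[ K ] a′ ⊛ b′
⊛-cong-≈ K a≈a′ b≈b′ k k≤K = ∑-cong-∈ (upTo (suc k)) λ {i} i∈ →
  let i≤k = ℕₚ.≤-pred (∈-upTo⁻ i∈) in
  cong₂ _*_ (a≈a′ i (ℕₚ.≤-trans i≤k k≤K)) (b≈b′ (k ∸ i) (ℕₚ.≤-trans (ℕₚ.m∸n≤m k i) k≤K))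

⊛-comm : ∀ a b → a ⊛ b ≐ b ⊛ a
⊛-comm a b k =
  ∑-reindex ℕ._≟_ ℕ._≟_ (upTo⁺ _) (upTo⁺ _) always always reflection
    (λ i → a i * b (k ∸ i)) (λ j → b j * a (k ∸ j))
    (λ {i} i∈ _ → trans (ℤₚ.*-comm (a i) (b (k ∸ i)))
                         (cong (λ l → b (k ∸ i) * a l) (sym (ℕₚ.m∸[m∸n]≡n (ℕₚ.≤-pred (∈-upTo⁻ i∈))))))
  where
  always : ℕ → Dec ⊤
  always _ = yes tt
  reflection : Correspondence (upTo (suc k)) _ (upTo (suc k)) _
  reflection = record
    { to = k ∸_ ; from = k ∸_
    ; to-∈ = λ {i} _ _ → ∈-upTo⁺ (s≤s (ℕₚ.m∸n≤m k i)) ; to-Q = λ _ _ → tt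
    ; from-∈ = λ {i} _ _ → ∈-upTo⁺ (s≤s (ℕₚ.m∸n≤m k i)) ; from-P = λ _ _ → tt
    ; from∘to = λ i∈ _ → ℕₚ.m∸[m∸n]≡n (ℕₚ.≤-pred (∈-upTo⁻ i∈))
    ; to∘from = λ i∈ _ → ℕₚ.m∸[m∸n]≡n (ℕₚ.≤-pred (∈-upTo⁻ i∈))
    }

∑-triangle : (k : ℕ) (f : ℕ → ℕ → ℤ) →
  ∑[ i ∈ upTo (suc k) ] ∑[ l ∈ upTo (suc i) ] f l i ≡
  ∑[ l ∈ upTo (suc k) ] ∑[ s ∈ upTo (suc (k ∸ l)) ] f l (s ℕ.+ l)
∑-triangle k f = begin
  ∑[ i ∈ upTo (suc k) ] ∑[ l ∈ upTo (suc i) ] f l i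
    ≡⟨ ∑-cong-∈ (upTo (suc k)) (λ i∈ → sym (widen i∈)) ⟩
  ∑[ i ∈ upTo (suc k) ] ∑[ l ∈ upTo (suc k) ] when (l ℕ.≤? i) (f l i)
    ≡⟨ ∑-swap (upTo (suc k)) (upTo (suc k)) (λ i l → when (l ℕ.≤? i) (f l i)) ⟩
  ∑[ l ∈ upTo (suc k) ] ∑[ i ∈ upTo (suc k) ] when (l ℕ.≤? i) (f l i)
    ≡⟨ ∑-cong-∈ (upTo (suc k)) shift ⟩
  ∑[ l ∈ upTo (suc k) ] ∑[ s ∈ upTo (suc (k ∸ l)) ] f l (s ℕ.+ l) ∎
  where
  open ≡-Reasoning
  widen : ∀ {i} → i ∈ upTo (suc k) →
          ∑[ l ∈ upTo (suc k) ] when (l ℕ.≤? i) (f l i) ≡ ∑[ l ∈ upTo (suc i) ] f l i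
  widen {i} i∈ =
    trans (∑-upTo-extend (λ l → when (l ℕ.≤? i) (f l i)) (∈-upTo⁻ i∈) (λ l i<l → when-no (l ℕ.≤? i) (ℕₚ.<⇒≱ i<l)))
          (∑-cong-∈ (upTo (suc i)) {f = λ l → when (l ℕ.≤? i) (f l i)} (λ {l} l∈ → when-yes (l ℕ.≤? i) (ℕₚ.≤-pred (∈-upTo⁻ l∈))))
  shift : ∀ {l} → l ∈ upTo (suc k) →
          ∑[ i ∈ upTo (suc k) ] when (l ℕ.≤? i) (f l i) ≡ ∑[ s ∈ upTo (suc (k ∸ l)) ] f l (s ℕ.+ l)
  shift {l} l∈ =
    ∑-reindex ℕ._≟_ ℕ._≟_ (upTo⁺ _) (upTo⁺ _) (l ℕ.≤?_) (λ _ → yes tt) translation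
      (f l) (λ s → f l (s ℕ.+ l)) (λ _ l≤i → cong (f l) (sym (ℕₚ.m∸n+n≡m l≤i)))
    where
    l≤k = ℕₚ.≤-pred (∈-upTo⁻ l∈)
    translation : Correspondence (upTo (suc k)) (l ℕ.≤_) (upTo (suc (k ∸ l))) (λ _ → ⊤)
    translation = record
      { to = _∸ l ; from = ℕ._+ l
      ; to-∈ = λ i∈ _ → ∈-upTo⁺ (s≤s (ℕₚ.∸-monoˡ-≤ l (ℕₚ.≤-pred (∈-upTo⁻ i∈))))
      ; to-Q = λ _ _ → tt
      ; from-∈ = λ {s} s∈ _ → ∈-upTo⁺ (s≤s (ℕₚ.m≤o∸n⇒m+n≤o s l≤k (ℕₚ.≤-pred (∈-upTo⁻ s∈))))
      ; from-P = λ {s} _ _ → ℕₚ.m≤n+m l s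
      ; from∘to = λ _ l≤i → ℕₚ.m∸n+n≡m l≤i
      ; to∘from = λ {s} _ _ → ℕₚ.m+n∸n≡m s l
      }

⊛-assoc : ∀ a b c → (a ⊛ b) ⊛ c ≐ a ⊛ (b ⊛ c)
⊛-assoc a b c k = begin
  ∑[ i ∈ upTo (suc k) ] (∑[ l ∈ upTo (suc i) ] (a l * b (i ∸ l))) * c (k ∸ i)
    ≡⟨ ∑-cong (upTo (suc k)) (λ i → ∑-*ʳ (upTo (suc i)) (c (k ∸ i)) (λ l → a l * b (i ∸ l))) ⟩
  ∑[ i ∈ upTo (suc k) ] ∑[ l ∈ upTo (suc i) ] (a l * b (i ∸ l) * c (k ∸ i))
    ≡⟨ ∑-triangle k (λ l i → a l * b (i ∸ l) * c (k ∸ i)) ⟩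
  ∑[ l ∈ upTo (suc k) ] ∑[ s ∈ upTo (suc (k ∸ l)) ] (a l * b (s ℕ.+ l ∸ l) * c (k ∸ (s ℕ.+ l)))
    ≡⟨ ∑-cong (upTo (suc k)) (λ l → ∑-cong (upTo (suc (k ∸ l))) (λ s → regroup l s)) ⟩
  ∑[ l ∈ upTo (suc k) ] ∑[ s ∈ upTo (suc (k ∸ l)) ] (a l * (b s * c (k ∸ l ∸ s)))
    ≡⟨ ∑-cong (upTo (suc k)) (λ l → sym (∑-*ˡ (upTo (suc (k ∸ l))) (a l) (λ s → b s * c (k ∸ l ∸ s)))) ⟩
  ∑[ l ∈ upTo (suc k) ] a l * (∑[ s ∈ upTo (suc (k ∸ l)) ] (b s * c (k ∸ l ∸ s))) ∎
  where
  open ≡-Reasoning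
  regroup : ∀ l s → a l * b (s ℕ.+ l ∸ l) * c (k ∸ (s ℕ.+ l)) ≡ a l * (b s * c (k ∸ l ∸ s))
  regroup l s = trans (ℤₚ.*-assoc (a l) _ _)
    (cong₂ (λ u v → a l * (b u * c v)) (ℕₚ.m+n∸n≡m s l)
           (trans (cong (k ∸_) (ℕₚ.+-comm s l)) (sym (ℕₚ.∸-+-assoc k l s))))

X^-⊛ : ∀ c a j → (X^ c ⊛ a) j ≡ when (c ℕ.≤? j) (a (j ∸ c))
X^-⊛ c a j = begin
  ∑[ i ∈ upTo (suc j) ] (when (c ℕ.≟ i) 1ℤ * a (j ∸ i))
    ≡⟨ ∑-cong (upTo (suc j)) (λ i → trans (when1-* (c ℕ.≟ i) _) (when-cong (c ℕ.≟ i) (i ℕ.≟ c) sym sym (λ _ → refl))) ⟩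
  ∑[ i ∈ upTo (suc j) ] when (i ℕ.≟ c) (a (j ∸ i))
    ≡⟨ ∑-upTo-delta (suc j) c (λ i → a (j ∸ i)) ⟩
  when (c ℕ.<? suc j) (a (j ∸ c))
    ≡⟨ when-cong (c ℕ.<? suc j) (c ℕ.≤? j) ℕₚ.≤-pred s≤s (λ _ → refl) ⟩
  when (c ℕ.≤? j) (a (j ∸ c)) ∎
  where open ≡-Reasoning

⊛-identityˡ : ∀ a → one ⊛ a ≐ a
⊛-identityˡ a j = trans (⊛-congˡ a (λ i → sym (X^0≐one i)) j) (X^-⊛ 0 a j)

⊛-identityʳ : ∀ a → a ⊛ one ≐ a
⊛-identityʳ a j = trans (⊛-comm a one j) (⊛-identityˡ a j)

X^-⊛-X^ : ∀ c d → X^ c ⊛ X^ d ≐ X^ (c ℕ.+ d)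
X^-⊛-X^ c d j = trans (X^-⊛ c (X^ d) j) (split (c ℕ.≤? j))
  where
  split : (c≤?j : Dec (c ℕ.≤ j)) → when c≤?j (when (d ℕ.≟ j ∸ c) 1ℤ) ≡ when (c ℕ.+ d ℕ.≟ j) 1ℤ
  split (yes c≤j) = when-cong (d ℕ.≟ j ∸ c) (c ℕ.+ d ℕ.≟ j)
    (λ d≡ → trans (cong (c ℕ.+_) d≡) (ℕₚ.m+[n∸m]≡n c≤j))
    (λ c+d≡ → trans (sym (ℕₚ.m+n∸m≡n c d)) (cong (_∸ c) c+d≡))
    (λ _ → refl)
  split (no c≰j) = sym (when-no (c ℕ.+ d ℕ.≟ j) (λ c+d≡ → c≰j (subst (c ℕ.≤_) c+d≡ (ℕₚ.m≤m+n c d))))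

·ˢ-⊛ : ∀ c a b → (c ·ˢ a) ⊛ b ≐ c ·ˢ (a ⊛ b)
·ˢ-⊛ c a b j = trans (∑-cong (upTo (suc j)) (λ i → ℤₚ.*-assoc c (a i) (b (j ∸ i))))
                     (sym (∑-*ˡ (upTo (suc j)) c (λ i → a i * b (j ∸ i))))

⊛-·ˢ : ∀ c a b → a ⊛ (c ·ˢ b) ≐ c ·ˢ (a ⊛ b)
⊛-·ˢ c a b j = trans (∑-cong (upTo (suc j)) (λ i → *-CS.x∙yz≈y∙xz (a i) c (b (j ∸ i))))
                     (sym (∑-*ˡ (upTo (suc j)) c (λ i → a i * b (j ∸ i))))

·ˢ-·ˢ : ∀ c c′ a → c ·ˢ (c′ ·ˢ a) ≐ (c * c′) ·ˢ a
·ˢ-·ˢ c c′ a j = sym (ℤₚ.*-assoc c c′ (a j))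

·ˢ-cong : ∀ c {a b} → a ≐ b → c ·ˢ a ≐ c ·ˢ b
·ˢ-cong c a≐b j = cong (c *_) (a≐b j)

·ˢ-cong-≈ : ∀ c {a b} K → a ≈[ K ] b → c ·ˢ a ≈[ K ] c ·ˢ b
·ˢ-cong-≈ c K a≈b j j≤K = cong (c *_) (a≈b j j≤K)

∑ˢ-cong : (xs : List A) {f g : A → Series} → (∀ x → f x ≐ g x) → ∑ˢ xs f ≐ ∑ˢ xs g
∑ˢ-cong xs f≐g j = ∑-cong xs (λ x → f≐g x j)

∑ˢ-cong-≈ : (xs : List A) {f g : A → Series} (K : ℕ) → (∀ x → f x ≈[ K ] g x) → ∑ˢ xs f ≈[ K ] ∑ˢ xs g
∑ˢ-cong-≈ xs K f≈g j j≤K = ∑-cong xs (λ x → f≈g x j j≤K)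

∑ˢ-⊛ : (xs : List A) (f : A → Series) (b : Series) → ∑ˢ xs f ⊛ b ≐ ∑ˢ[ x ∈ xs ] (f x ⊛ b)
∑ˢ-⊛ xs f b j = trans (∑-cong (upTo (suc j)) (λ i → ∑-*ʳ xs (b (j ∸ i)) (λ x → f x i)))
                      (∑-swap (upTo (suc j)) xs (λ i x → f x i * b (j ∸ i)))

∑ˢ-·ˢ-⊛ : (xs : List A) (c : A → ℤ) (f : A → Series) (b : Series) →
           (∑ˢ[ x ∈ xs ] c x ·ˢ f x) ⊛ b ≐ ∑ˢ[ x ∈ xs ] c x ·ˢ (f x ⊛ b)
∑ˢ-·ˢ-⊛ xs c f b j = trans (∑ˢ-⊛ xs (λ x → c x ·ˢ f x) b j) (∑-cong xs (λ x → ·ˢ-⊛ (c x) (f x) b j))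

⊛-∑ˢ : (xs : List A) (f : A → Series) (b : Series) → b ⊛ ∑ˢ xs f ≐ ∑ˢ[ x ∈ xs ] (b ⊛ f x)
⊛-∑ˢ xs f b j = trans (⊛-comm b (∑ˢ xs f) j)
               (trans (∑ˢ-⊛ xs f b j) (∑-cong xs (λ x → ⊛-comm (f x) b j)))

⊛-interchange : ∀ a b c d → (a ⊛ b) ⊛ (c ⊛ d) ≐ (a ⊛ c) ⊛ (b ⊛ d)
⊛-interchange a b c d = begin
  (a ⊛ b) ⊛ (c ⊛ d)  ≈⟨ ⊛-assoc a b (c ⊛ d) ⟩
  a ⊛ (b ⊛ (c ⊛ d))  ≈⟨ ⊛-congʳ a (λ j → sym (⊛-assoc b c d j)) ⟩
  a ⊛ ((b ⊛ c) ⊛ d)  ≈⟨ ⊛-congʳ a (⊛-congˡ d (⊛-comm b c)) ⟩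
  a ⊛ ((c ⊛ b) ⊛ d)  ≈⟨ ⊛-congʳ a (⊛-assoc c b d) ⟩
  a ⊛ (c ⊛ (b ⊛ d))  ≈⟨ (λ j → sym (⊛-assoc a c (b ⊛ d) j)) ⟩
  (a ⊛ c) ⊛ (b ⊛ d)  ∎
  where open SetoidReasoning ≐-setoid

^ˢ-distrib-⊛ : ∀ a b m → (a ⊛ b) ^ˢ m ≐ (a ^ˢ m) ⊛ (b ^ˢ m)
^ˢ-distrib-⊛ a b zero j = sym (⊛-identityˡ one j)
^ˢ-distrib-⊛ a b (suc m) j =
  trans (⊛-congʳ (a ⊛ b) (^ˢ-distrib-⊛ a b m) j) (⊛-interchange a b (a ^ˢ m) (b ^ˢ m) j)

^ˢ-cong-≈ : ∀ {a b} K m → a ≈[ K ] b → a ^ˢ m ≈[ K ] b ^ˢ m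
^ˢ-cong-≈ K zero a≈b j j≤K = refl
^ˢ-cong-≈ K (suc m) a≈b = ⊛-cong-≈ K a≈b (^ˢ-cong-≈ K m a≈b)

one-^ˢ : ∀ m → one ^ˢ m ≐ one
one-^ˢ zero j = refl
one-^ˢ (suc m) j = trans (⊛-identityˡ (one ^ˢ m) j) (one-^ˢ m j)

X^-^ˢ : ∀ c m → X^ c ^ˢ m ≐ X^ (m ℕ.* c)
X^-^ˢ c zero j = sym (X^0≐one j)
X^-^ˢ c (suc m) j = trans (⊛-congʳ (X^ c) (X^-^ˢ c m) j) (X^-⊛-X^ c (m ℕ.* c) j)

^ˢ-constant : ∀ a m → a 0 ≡ 1ℤ → (a ^ˢ m) 0 ≡ 1ℤ
^ˢ-constant a zero a₀≡1 = refl
^ˢ-constant a (suc m) a₀≡1 =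
  trans (ℤₚ.+-identityʳ _) (cong₂ _*_ a₀≡1 (^ˢ-constant a m a₀≡1))

vectors : List A → (m : ℕ) → List (Vec A m)
vectors xs zero = [] ∷ []
vectors xs (suc m) = concatMap (λ x → map (x ∷_) (vectors xs m)) xs

∑-vectors : (xs : List A) (m : ℕ) (f : Vec A (suc m) → ℤ) →
            ∑ (vectors xs (suc m)) f ≡ ∑[ x ∈ xs ] ∑[ t ∈ vectors xs m ] f (x ∷ t)
∑-vectors xs m f = trans (∑-concatMap (λ x → map (x ∷_) (vectors xs m)) xs f)
                         (∑-cong xs (λ x → ∑-map (x ∷_) (vectors xs m) f))

∏ᵛ : (A → ℤ) → Vec A m → ℤ
∏ᵛ w [] = 1ℤ
∏ᵛ w (x ∷ t) = w x * ∏ᵛ w t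

∑ᵛ : (A → ℕ) → Vec A m → ℕ
∑ᵛ d t = Vec.sum (Vec.map d t)

monomial-⊛ : ∀ c d c′ d′ → (c ·ˢ X^ d) ⊛ (c′ ·ˢ X^ d′) ≐ (c * c′) ·ˢ X^ (d ℕ.+ d′)
monomial-⊛ c d c′ d′ = begin
  (c ·ˢ X^ d) ⊛ (c′ ·ˢ X^ d′)    ≈⟨ ·ˢ-⊛ c (X^ d) (c′ ·ˢ X^ d′) ⟩
  c ·ˢ (X^ d ⊛ (c′ ·ˢ X^ d′))    ≈⟨ ·ˢ-cong c (⊛-·ˢ c′ (X^ d) (X^ d′)) ⟩
  c ·ˢ c′ ·ˢ (X^ d ⊛ X^ d′)      ≈⟨ ·ˢ-·ˢ c c′ (X^ d ⊛ X^ d′) ⟩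
  (c * c′) ·ˢ (X^ d ⊛ X^ d′)     ≈⟨ ·ˢ-cong (c * c′) (X^-⊛-X^ d d′) ⟩
  (c * c′) ·ˢ X^ (d ℕ.+ d′)      ∎
  where open SetoidReasoning ≐-setoid

^ˢ-∑ˢ : (xs : List A) (w : A → ℤ) (d : A → ℕ) (m : ℕ) →
        (∑ˢ[ x ∈ xs ] w x ·ˢ X^ d x) ^ˢ m ≐ ∑ˢ[ t ∈ vectors xs m ] ∏ᵛ w t ·ˢ X^ ∑ᵛ d t
^ˢ-∑ˢ xs w d zero j = sym (trans (ℤₚ.+-identityʳ _) (trans (ℤₚ.*-identityˡ _) (X^0≐one j)))
^ˢ-∑ˢ xs w d (suc m) = begin
  S ⊛ (S ^ˢ m)
    ≈⟨ ⊛-congʳ S (^ˢ-∑ˢ xs w d m) ⟩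
  S ⊛ (∑ˢ[ t ∈ vectors xs m ] ∏ᵛ w t ·ˢ X^ ∑ᵛ d t)
    ≈⟨ ∑ˢ-⊛ xs (λ x → w x ·ˢ X^ d x) _ ⟩
  ∑ˢ[ x ∈ xs ] (w x ·ˢ X^ d x) ⊛ (∑ˢ[ t ∈ vectors xs m ] ∏ᵛ w t ·ˢ X^ ∑ᵛ d t)
    ≈⟨ ∑ˢ-cong xs (λ x → ⊛-∑ˢ (vectors xs m) (λ t → ∏ᵛ w t ·ˢ X^ ∑ᵛ d t) (w x ·ˢ X^ d x)) ⟩
  ∑ˢ[ x ∈ xs ] ∑ˢ[ t ∈ vectors xs m ] (w x ·ˢ X^ d x) ⊛ (∏ᵛ w t ·ˢ X^ ∑ᵛ d t)
    ≈⟨ ∑ˢ-cong xs (λ x → ∑ˢ-cong (vectors xs m) (λ t → monomial-⊛ (w x) (d x) (∏ᵛ w t) (∑ᵛ d t))) ⟩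
  ∑ˢ[ x ∈ xs ] ∑ˢ[ t ∈ vectors xs m ] ∏ᵛ w (x ∷ t) ·ˢ X^ ∑ᵛ d (x ∷ t)
    ≈⟨ (λ j → sym (∑-vectors xs m (λ t → (∏ᵛ w t ·ˢ X^ ∑ᵛ d t) j))) ⟩
  ∑ˢ[ t ∈ vectors xs (suc m) ] ∏ᵛ w t ·ˢ X^ ∑ᵛ d t ∎
  where
  open SetoidReasoning ≐-setoid
  S = ∑ˢ[ x ∈ xs ] w x ·ˢ X^ d x

private
  -- The summand of substPow is a where-bound helper of Defs that cannot be
  -- named; abstracting the list and _+_ lets unification extract it.
  substPow-summand : (a : Series) (m k : ℕ) →
    Σ (ℕ → ℤ) λ f → substPow a m k ≡ sumℤ (map f (upTo (suc k)))
  substPow-summand a m k with applyUpTo suc k | _+_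
  ... | _ | _ = _ , refl

  substPow-summand-≡ : ∀ a m k j → proj₁ (substPow-summand a m k) j ≡ when (j ℕ.* m ℕ.≟ k) (a j)
  substPow-summand-≡ a m k j with j ℕ.* m ℕ.≟ k
  ... | yes _ = refl
  ... | no _ = refl

substPow-∑ : ∀ a m k → substPow a m k ≡ ∑[ j ∈ upTo (suc k) ] when (j ℕ.* m ℕ.≟ k) (a j)
substPow-∑ a m k = trans (proj₂ (substPow-summand a m k)) (∑-cong (upTo (suc k)) (substPow-summand-≡ a m k))

substPow-cong-≈ : ∀ {a b} K m → a ≈[ K ] b → substPow a m ≈[ K ] substPow b m
substPow-cong-≈ {a} {b} K m a≈b k k≤K = begin
  substPow a m k                                          ≡⟨ substPow-∑ a m k ⟩
  ∑[ j ∈ upTo (suc k) ] when (j ℕ.* m ℕ.≟ k) (a j)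
    ≡⟨ ∑-cong-∈ (upTo (suc k)) (λ {j} j∈ → cong (when (j ℕ.* m ℕ.≟ k))
         (a≈b j (ℕₚ.≤-trans (ℕₚ.≤-pred (∈-upTo⁻ j∈)) k≤K))) ⟩
  ∑[ j ∈ upTo (suc k) ] when (j ℕ.* m ℕ.≟ k) (b j)      ≡⟨ substPow-∑ b m k ⟨
  substPow b m k                                          ∎
  where open ≡-Reasoning

substPow-∑ˢ : (xs : List A) (w : A → ℤ) (d : A → ℕ) (m : ℕ) →
  substPow (∑ˢ[ x ∈ xs ] w x ·ˢ X^ d x) (suc m) ≐ ∑ˢ[ x ∈ xs ] w x ·ˢ X^ (d x ℕ.* suc m)
substPow-∑ˢ xs w d m k = begin
  substPow (∑ˢ[ x ∈ xs ] w x ·ˢ X^ d x) (suc m) k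
    ≡⟨ substPow-∑ _ (suc m) k ⟩
  ∑[ j ∈ upTo (suc k) ] when (j ℕ.* suc m ℕ.≟ k) (∑[ x ∈ xs ] w x * when (d x ℕ.≟ j) 1ℤ)
    ≡⟨ ∑-cong (upTo (suc k)) (λ j → sym (∑-when xs (j ℕ.* suc m ℕ.≟ k) _)) ⟩
  ∑[ j ∈ upTo (suc k) ] ∑[ x ∈ xs ] when (j ℕ.* suc m ℕ.≟ k) (w x * when (d x ℕ.≟ j) 1ℤ)
    ≡⟨ ∑-swap (upTo (suc k)) xs _ ⟩
  ∑[ x ∈ xs ] ∑[ j ∈ upTo (suc k) ] when (j ℕ.* suc m ℕ.≟ k) (w x * when (d x ℕ.≟ j) 1ℤ)
    ≡⟨ ∑-cong xs (λ x → ∑-cong (upTo (suc k)) (λ j → swap-conditions (w x) (d x) j)) ⟩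
  ∑[ x ∈ xs ] ∑[ j ∈ upTo (suc k) ] when (j ℕ.≟ d x) (when (j ℕ.* suc m ℕ.≟ k) (w x))
    ≡⟨ ∑-cong xs (λ x → ∑-upTo-delta (suc k) (d x) (λ j → when (j ℕ.* suc m ℕ.≟ k) (w x))) ⟩
  ∑[ x ∈ xs ] when (d x ℕ.<? suc k) (when (d x ℕ.* suc m ℕ.≟ k) (w x))
    ≡⟨ ∑-cong xs (λ x → in-range (w x) (d x)) ⟩
  ∑[ x ∈ xs ] w x * when (d x ℕ.* suc m ℕ.≟ k) 1ℤ ∎
  where
  open ≡-Reasoning
  swap-conditions : ∀ c d j → when (j ℕ.* suc m ℕ.≟ k) (c * when (d ℕ.≟ j) 1ℤ) ≡
                              when (j ℕ.≟ d) (when (j ℕ.* suc m ℕ.≟ k) c)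
  swap-conditions c d j =
    trans (cong (when (j ℕ.* suc m ℕ.≟ k)) (*-when1 (d ℕ.≟ j) c))
          (trans (when-comm (j ℕ.* suc m ℕ.≟ k) (d ℕ.≟ j) c) (when-cong (d ℕ.≟ j) (j ℕ.≟ d) sym sym (λ _ → refl)))
  in-range : ∀ c d → when (d ℕ.<? suc k) (when (d ℕ.* suc m ℕ.≟ k) c) ≡ c * when (d ℕ.* suc m ℕ.≟ k) 1ℤ
  in-range c d with d ℕ.<? suc k
  ... | yes _ = sym (*-when1 (d ℕ.* suc m ℕ.≟ k) c)
  ... | no d≮1+k = sym (trans (*-when1 (d ℕ.* suc m ℕ.≟ k) c)
                       (when-no (d ℕ.* suc m ℕ.≟ k) (λ dm≡k → d≮1+k (s≤s (subst (d ℕ.≤_) dm≡k (ℕₚ.m≤m*n d (suc m)))))))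

private
  -- (a − q₀ b)/x, with q₀ = a 0 + - 0ℤ the first quotient coefficient exactly as
  -- divPrefix computes it.
  peel : Series → Series → Series
  peel a b i = a (suc i) + - (b (suc i) * (a 0 + - 0ℤ))

  zipWith-applyUpTo-suc : ∀ (f : ℕ → ℤ → ℤ) (g : ℕ → ℕ) n (ys : List ℤ) →
    zipWith f (applyUpTo (λ i → suc (g i)) n) ys ≡ zipWith (λ i → f (suc i)) (applyUpTo g n) ys
  zipWith-applyUpTo-suc f g zero ys = refl
  zipWith-applyUpTo-suc f g (suc n) [] = refl
  zipWith-applyUpTo-suc f g (suc n) (y ∷ ys) =
    cong (f (suc (g 0)) y ∷_) (zipWith-applyUpTo-suc f (λ i → g (suc i)) n ys)

  divPrefix-peel : ∀ a b n → divPrefix a b (suc n) ≡ (a 0 + - 0ℤ) ∷ divPrefix (peel a b) b n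
  divPrefix-peel a b zero = refl
  divPrefix-peel a b (suc n) rewrite divPrefix-peel a b n =
    cong (λ q → (a 0 + - 0ℤ) ∷ (divPrefix (peel a b) b n ++ q ∷ []))
      (trans (cong (λ l → a (suc n) + - (b (suc n) * (a 0 + - 0ℤ) + sumℤ l))
                   (zipWith-applyUpTo-suc (λ i qᵢ → b (suc n ∸ i) * qᵢ) (λ i → i) n (divPrefix (peel a b) b n)))
             (x-[y+z]≡x-y-z (a (suc n)) _ _))
    where
    x-[y+z]≡x-y-z : ∀ x y z → x + - (y + z) ≡ x + - y + - z
    x-[y+z]≡x-y-z = solve-∀

  snoc-is-cons : (xs : List ℤ) (x : ℤ) → Σ ℤ λ y → Σ (List ℤ) λ ys → xs ++ x ∷ [] ≡ y ∷ ys
  snoc-is-cons [] x = x , [] , refl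
  snoc-is-cons (x′ ∷ xs) x = x′ , xs ++ x ∷ [] , refl

  -- divSeries reads the last entry of the prefix with a function local to Defs,
  -- which unfolds only on a visible cons; hence the quotient is computed by
  -- peeling off one coefficient at a time rather than by induction on the prefix.
  divSeries-peel : ∀ a b k → divSeries a b (suc k) ≡ divSeries (peel a b) b k
  divSeries-peel a b k with snoc-is-cons (divPrefix (peel a b) b k)
    (peel a b k + - sumℤ (zipWith (λ i qᵢ → b (k ∸ i) * qᵢ) (upTo k) (divPrefix (peel a b) b k)))
  ... | _ , _ , ≡cons rewrite divPrefix-peel a b (suc k) | ≡cons = refl

  quotient-head : (a b h : Series) → b 0 ≡ 1ℤ → a 0 ≡ (b ⊛ h) 0 → a 0 + - 0ℤ ≡ h 0
  quotient-head a b h b₀≡1 a₀≡ = begin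
    a 0 + - 0ℤ          ≡⟨ ℤₚ.+-identityʳ (a 0) ⟩
    a 0                 ≡⟨ a₀≡ ⟩
    b 0 * h 0 + 0ℤ      ≡⟨ ℤₚ.+-identityʳ (b 0 * h 0) ⟩
    b 0 * h 0           ≡⟨ cong (_* h 0) b₀≡1 ⟩
    1ℤ * h 0            ≡⟨ ℤₚ.*-identityˡ (h 0) ⟩
    h 0                 ∎
    where open ≡-Reasoning

divSeries-unique : ∀ k (a b h : Series) → b 0 ≡ 1ℤ → a ≈[ k ] b ⊛ h → divSeries a b k ≡ h k
divSeries-unique zero a b h b₀≡1 a≈bh = quotient-head a b h b₀≡1 (a≈bh 0 z≤n)
divSeries-unique (suc k) a b h b₀≡1 a≈bh =
  trans (divSeries-peel a b k) (divSeries-unique k (peel a b) b (λ i → h (suc i)) b₀≡1 peel≈)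
  where
  peel≈ : peel a b ≈[ k ] b ⊛ (λ i → h (suc i))
  peel≈ j j≤k = begin
    a (suc j) + - (b (suc j) * (a 0 + - 0ℤ))
      ≡⟨ cong₂ (λ u v → u + - (b (suc j) * v)) (a≈bh (suc j) (s≤s j≤k)) (quotient-head a b h b₀≡1 (a≈bh 0 z≤n)) ⟩
    (b ⊛ h) (suc j) + - (b (suc j) * h 0)
      ≡⟨ cong (λ u → u + - (b (suc j) * h 0)) (∑-upTo-suc (suc j) (λ i → b i * h (suc j ∸ i))) ⟩
    (∑[ i ∈ upTo (suc j) ] b i * h (suc j ∸ i)) + b (suc j) * h (suc j ∸ suc j) + - (b (suc j) * h 0)
      ≡⟨ cong (λ l → (∑[ i ∈ upTo (suc j) ] b i * h (suc j ∸ i)) + b (suc j) * h l + - (b (suc j) * h 0)) (ℕₚ.n∸n≡0 j) ⟩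
    (∑[ i ∈ upTo (suc j) ] b i * h (suc j ∸ i)) + b (suc j) * h 0 + - (b (suc j) * h 0)
      ≡⟨ x+y-y≡x _ _ ⟩
    ∑[ i ∈ upTo (suc j) ] b i * h (suc j ∸ i)
      ≡⟨ ∑-cong-∈ (upTo (suc j)) (λ {i} i∈ → cong (λ l → b i * h l) (ℕₚ.+-∸-assoc 1 (ℕₚ.≤-pred (∈-upTo⁻ i∈)))) ⟩
    ∑[ i ∈ upTo (suc j) ] b i * h (suc (j ∸ i)) ∎
    where
    open ≡-Reasoning
    x+y-y≡x : ∀ x y → x + y + - y ≡ x
    x+y-y≡x = solve-∀

-- Finite graded lattices

module _ {P : A → Set} (P? : Decidable P) (f : A → ℕ) where

  maximal : (xs : List A) {x₀ : A} → P x₀ → Σ A λ b → P b × (∀ {y} → y ∈ xs → P y → f y ℕ.≤ f b)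
  maximal xs {x₀} px₀ =
    argmax f x₀ (filter P? xs) ,
    argmax-all f px₀ (all-filter P? xs) ,
    λ y∈ py → All.lookup (f[xs]≤f[argmax] x₀ (filter P? xs)) (∈-filter⁺ P? y∈ py)

module _ {P Q : A → Set} (P? : Decidable P) (Q? : Decidable Q) (P⇒Q : ∀ {x} → P x → Q x) where

  length-filter-mono : ∀ xs → length (filter P? xs) ℕ.≤ length (filter Q? xs)
  length-filter-mono [] = z≤n
  length-filter-mono (x ∷ xs) with P? x | Q? x
  ... | yes _  | yes _  = s≤s (length-filter-mono xs)
  ... | yes px | no ¬qx = ⊥-elim (¬qx (P⇒Q px))
  ... | no _   | yes _  = ℕₚ.m≤n⇒m≤1+n (length-filter-mono xs)
  ... | no _   | no _   = length-filter-mono xs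

  length-filter-< : ∀ xs {x} → x ∈ xs → Q x → ¬ P x → length (filter P? xs) ℕ.< length (filter Q? xs)
  length-filter-< (x ∷ xs) (here refl) qx ¬px with P? x | Q? x
  ... | yes px | _      = ⊥-elim (¬px px)
  ... | no _   | yes _  = s≤s (length-filter-mono xs)
  ... | no _   | no ¬qx = ⊥-elim (¬qx qx)
  length-filter-< (y ∷ xs) (there x∈) qx ¬px with P? y | Q? y
  ... | yes _  | yes _  = s≤s (length-filter-< xs x∈ qx ¬px)
  ... | yes py | no ¬qy = ⊥-elim (¬qy (P⇒Q py))
  ... | no _   | yes _  = ℕₚ.m≤n⇒m≤1+n (length-filter-< xs x∈ qx ¬px)
  ... | no _   | no _   = length-filter-< xs x∈ qx ¬px

module FiniteGradedLatticeProperties (L : FiniteGradedLattice) where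

  open FiniteGradedLattice L public
  module ≤ = IsLattice isLattice

  _<_ : Fin n → Fin n → Set
  _<_ = Lt _≤_

  <-≤-trans : ∀ {a b c} → a < b → b ≤ c → a < c
  <-≤-trans (a≤b , a≢b) b≤c = ≤.trans a≤b b≤c , λ { refl → a≢b (≤.antisym a≤b b≤c) }

  <-irrefl : ∀ {a} → ¬ a < a
  <-irrefl (_ , a≢a) = a≢a refl

  #below : Fin n → ℕ
  #below p = length (filter (_<? p) (allFin n))

  #below-mono : ∀ {q p} → q < p → #below q ℕ.< #below p
  #below-mono {q} {p} q<p =
    length-filter-< (_<? q) (_<? p) (λ r<q → <-≤-trans r<q (proj₁ q<p)) (allFin n) (∈-allFin q) q<p <-irrefl

  #below<n : ∀ p → #below p ℕ.< n
  #below<n p = subst (#below p ℕ.<_) (Listₚ.length-tabulate (λ i → i))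
    (Listₚ.filter-notAll (_<? p) (allFin n) (Any.map (λ { refl → <-irrefl }) (∈-allFin p)))

  -- The recursion for μ(0̂,p) only visits elements strictly below p, along which
  -- #below strictly decreases; so any fuel exceeding #below p computes μ(0̂,p).
  mobiusFuel-stable : ∀ f f′ p → #below p ℕ.< f → #below p ℕ.< f′ → mobiusFuel f p ≡ mobiusFuel f′ p
  mobiusFuel-stable (suc f) (suc f′) p _ _ with p Fin.≟ bot
  ... | yes _ = refl
  mobiusFuel-stable (suc f) (suc f′) p (s≤s #p≤f) (s≤s #p≤f′) | no _ = cong -_ (begin
    ∑ (filter (_<? p) (allFin n)) (mobiusFuel f)
      ≡⟨ ∑-filter (_<? p) (allFin n) (mobiusFuel f) ⟩
    ∑[ q ∈ allFin n ] when (q <? p) (mobiusFuel f q)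
      ≡⟨ ∑-cong (allFin n) (λ q → when-congʳ (q <? p) (λ q<p →
           mobiusFuel-stable f f′ q (ℕₚ.<-≤-trans (#below-mono q<p) #p≤f) (ℕₚ.<-≤-trans (#below-mono q<p) #p≤f′))) ⟩
    ∑[ q ∈ allFin n ] when (q <? p) (mobiusFuel f′ q)
      ≡⟨ ∑-filter (_<? p) (allFin n) (mobiusFuel f′) ⟨
    ∑ (filter (_<? p) (allFin n)) (mobiusFuel f′) ∎)
    where open ≡-Reasoning

  private
    mobiusFuel-bot : ∀ f → mobiusFuel (suc f) bot ≡ 1ℤ
    mobiusFuel-bot f with bot Fin.≟ bot
    ... | yes _ = refl
    ... | no bot≢bot = ⊥-elim (bot≢bot refl)

    mobiusFuel-suc : ∀ f p → ¬ p ≡ bot → mobiusFuel (suc f) p ≡ - ∑ (filter (_<? p) (allFin n)) (mobiusFuel f)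
    mobiusFuel-suc f p p≢bot with p Fin.≟ bot
    ... | yes p≡bot = ⊥-elim (p≢bot p≡bot)
    ... | no _ = refl

  mobius-bot : mobius bot ≡ 1ℤ
  mobius-bot = trans (mobiusFuel-stable n (suc (#below bot)) bot (#below<n bot) (ℕₚ.n<1+n _)) (mobiusFuel-bot _)

  mobius-unfold : ∀ p → ¬ p ≡ bot → mobius p ≡ - (∑[ q ∈ allFin n ] when (q <? p) (mobius q))
  mobius-unfold p p≢bot = begin
    mobius p
      ≡⟨ mobiusFuel-stable n (suc (#below p)) p (#below<n p) (ℕₚ.n<1+n _) ⟩
    mobiusFuel (suc (#below p)) p
      ≡⟨ mobiusFuel-suc (#below p) p p≢bot ⟩
    - ∑ (filter (_<? p) (allFin n)) (mobiusFuel (#below p))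
      ≡⟨ cong -_ (∑-filter (_<? p) (allFin n) (mobiusFuel (#below p))) ⟩
    - (∑[ q ∈ allFin n ] when (q <? p) (mobiusFuel (#below p) q))
      ≡⟨ cong -_ (∑-cong (allFin n) (λ q → when-congʳ (q <? p) (λ q<p →
           mobiusFuel-stable (#below p) n q (#below-mono q<p) (#below<n q)))) ⟩
    - (∑[ q ∈ allFin n ] when (q <? p) (mobius q)) ∎
    where open ≡-Reasoning

  ∑-mobius-≤ : ∀ p → ∑[ q ∈ allFin n ] when (q ≤? p) (mobius q) ≡ when (p Fin.≟ bot) 1ℤ
  ∑-mobius-≤ p = begin
    ∑[ q ∈ allFin n ] when (q ≤? p) (mobius q)
      ≡⟨ ∑-cong (allFin n) (λ q → split q (mobius q)) ⟩
    ∑[ q ∈ allFin n ] (when (q <? p) (mobius q) + when (q Fin.≟ p) (mobius q))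
      ≡⟨ ∑-+ (allFin n) (λ q → when (q <? p) (mobius q)) (λ q → when (q Fin.≟ p) (mobius q)) ⟩
    S + (∑[ q ∈ allFin n ] when (q Fin.≟ p) (mobius q))
      ≡⟨ cong (_+_ S) (∑-delta Fin._≟_ (allFin n) p mobius (allFin⁺ n) (∈-allFin p)) ⟩
    S + mobius p
      ≡⟨ closing (p Fin.≟ bot) ⟩
    when (p Fin.≟ bot) 1ℤ ∎
    where
    open ≡-Reasoning
    S = ∑[ q ∈ allFin n ] when (q <? p) (mobius q)
    split : ∀ q z → when (q ≤? p) z ≡ when (q <? p) z + when (q Fin.≟ p) z
    split q z with q ≤? p | q Fin.≟ p
    ... | yes _   | yes _    = sym (ℤₚ.+-identityˡ z)
    ... | yes _   | no _     = sym (ℤₚ.+-identityʳ z)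
    ... | no q≰p  | yes refl = ⊥-elim (q≰p ≤.refl)
    ... | no _    | no _     = refl
    closing : (d : Dec (p ≡ bot)) → S + mobius p ≡ when d 1ℤ
    closing (yes refl) = cong₂ _+_ (∑-zero (allFin n) (λ {q} _ → when-no (q <? bot)
                                      (λ { (q≤bot , q≢bot) → q≢bot (≤.antisym q≤bot (bot-min q)) })))
                                   mobius-bot
    closing (no p≢bot) = trans (cong (_+_ S) (mobius-unfold p p≢bot)) (ℤₚ.+-inverseʳ S)

  covers-some : ∀ p → ¬ p ≡ bot → Σ (Fin n) λ c → Covers _≤_ c p
  covers-some p p≢bot with maximal (_<? p) #below (allFin n) (bot-min p , λ bot≡p → p≢bot (sym bot≡p))
  ... | c , c<p , c-max = c , c<p , λ z c≤z z≤p → nothing-between z c≤z z≤p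
    where
    nothing-between : ∀ z → c ≤ z → z ≤ p → (z ≡ c) ⊎ (z ≡ p)
    nothing-between z c≤z z≤p with z Fin.≟ c | z Fin.≟ p
    ... | yes z≡c | _       = inj₁ z≡c
    ... | no _    | yes z≡p = inj₂ z≡p
    ... | no z≢c  | no z≢p  = ⊥-elim (ℕₚ.<-irrefl refl
          (ℕₚ.<-≤-trans (#below-mono (c≤z , λ c≡z → z≢c (sym c≡z))) (c-max (∈-allFin z) (z≤p , z≢p))))

-- Upho lattices

module UphoLatticeProperties (U : UphoLattice) where

  open UphoLattice U
  module ≤ = IsLattice isLattice

  ρ-< : ∀ {x y} → x ≤ y → ¬ x ≡ y → ρ x ℕ.< ρ y
  ρ-< x≤y x≢y = ρ-strict _ _ (x≤y , x≢y)

  ρ-mono : ∀ {x y} → x ≤ y → ρ x ℕ.≤ ρ y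
  ρ-mono {x} {y} x≤y with ρ x ℕ.≤? ρ y
  ... | yes ρx≤ρy = ρx≤ρy
  ... | no ρx≰ρy = ⊥-elim (ρx≰ρy (ℕₚ.<⇒≤ (ρ-< x≤y λ { refl → ρx≰ρy ℕₚ.≤-refl })))

  ≤-foldr-∨ : ∀ {x} xs → x ∈ xs → x ≤ foldr _∨_ bot xs
  ≤-foldr-∨ (y ∷ ys) (here refl) = proj₁ (≤.supremum y (foldr _∨_ bot ys))
  ≤-foldr-∨ (y ∷ ys) (there x∈) = ≤.trans (≤-foldr-∨ ys x∈) (proj₁ (proj₂ (≤.supremum y (foldr _∨_ bot ys))))

  atom≤coreTop : ∀ {s} → s ∈ atoms → s ≤ coreTop
  atom≤coreTop = ≤-foldr-∨ atoms

  module _ (p : P) where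

    private
      φ = filterIso p
      φ⁻¹ = filterIso⁻¹ p

    filterIso-cong : ∀ u v → proj₁ u ≡ proj₁ v → φ u ≡ φ v
    filterIso-cong u v u≡v =
      ≤.antisym (filterIso-mono p u v (≤.reflexive u≡v)) (filterIso-mono p v u (≤.reflexive (sym u≡v)))

    filterIso-bot : ∀ p≤p → φ (p , p≤p) ≡ bot
    filterIso-bot p≤p = ≤.antisym
      (subst (φ (p , p≤p) ≤_) (filterIso-inv₁ p bot) (filterIso-mono p (p , p≤p) (φ⁻¹ bot) (proj₂ (φ⁻¹ bot))))
      (bot-min _)

    filterIso⁻¹-bot : proj₁ (φ⁻¹ bot) ≡ p
    filterIso⁻¹-bot = trans (cong (λ z → proj₁ (φ⁻¹ z)) (sym (filterIso-bot ≤.refl))) (filterIso-inv₂ p (p , ≤.refl))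

    private
      φ-reflectsʳ : ∀ u z → φ u ≤ z → proj₁ u ≤ proj₁ (φ⁻¹ z)
      φ-reflectsʳ u z φu≤z = filterIso-refl p u (φ⁻¹ z) (subst (φ u ≤_) (sym (filterIso-inv₁ p z)) φu≤z)

      φ-reflectsˡ : ∀ u z → z ≤ φ u → proj₁ (φ⁻¹ z) ≤ proj₁ u
      φ-reflectsˡ u z z≤φu = filterIso-refl p (φ⁻¹ z) u (subst (_≤ φ u) (sym (filterIso-inv₁ p z)) z≤φu)

    filterIso-cover : ∀ u v → Covers _≤_ (proj₁ u) (proj₁ v) → Covers _≤_ (φ u) (φ v)
    filterIso-cover u v ((u≤v , u≢v) , nothing-between) = (filterIso-mono p u v u≤v , φu≢φv) , between
      where
      φu≢φv : ¬ φ u ≡ φ v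
      φu≢φv φu≡φv = u≢v (trans (sym (filterIso-inv₂ p u))
                          (trans (cong (λ z → proj₁ (φ⁻¹ z)) φu≡φv) (filterIso-inv₂ p v)))
      between : ∀ z → φ u ≤ z → z ≤ φ v → (z ≡ φ u) ⊎ (z ≡ φ v)
      between z φu≤z z≤φv with nothing-between (proj₁ (φ⁻¹ z)) (φ-reflectsʳ u z φu≤z) (φ-reflectsˡ v z z≤φv)
      ... | inj₁ ≡u = inj₁ (trans (sym (filterIso-inv₁ p z)) (filterIso-cong (φ⁻¹ z) u ≡u))
      ... | inj₂ ≡v = inj₂ (trans (sym (filterIso-inv₁ p z)) (filterIso-cong (φ⁻¹ z) v ≡v))

    filterIso⁻¹-cover : ∀ y₁ y₂ → Covers _≤_ y₁ y₂ → Covers _≤_ (proj₁ (φ⁻¹ y₁)) (proj₁ (φ⁻¹ y₂))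
    filterIso⁻¹-cover y₁ y₂ ((y₁≤y₂ , y₁≢y₂) , nothing-between) = (≤′ , ≢′) , between
      where
      ≤′ : proj₁ (φ⁻¹ y₁) ≤ proj₁ (φ⁻¹ y₂)
      ≤′ = φ-reflectsʳ (φ⁻¹ y₁) y₂ (subst (_≤ y₂) (sym (filterIso-inv₁ p y₁)) y₁≤y₂)
      ≢′ : ¬ proj₁ (φ⁻¹ y₁) ≡ proj₁ (φ⁻¹ y₂)
      ≢′ ≡′ = y₁≢y₂ (trans (sym (filterIso-inv₁ p y₁))
                      (trans (filterIso-cong (φ⁻¹ y₁) (φ⁻¹ y₂) ≡′) (filterIso-inv₁ p y₂)))
      between : ∀ z → proj₁ (φ⁻¹ y₁) ≤ z → z ≤ proj₁ (φ⁻¹ y₂) → (z ≡ proj₁ (φ⁻¹ y₁)) ⊎ (z ≡ proj₁ (φ⁻¹ y₂))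
      between z y₁≤z z≤y₂ with nothing-between (φ (z , p≤z))
          (subst (_≤ φ (z , p≤z)) (filterIso-inv₁ p y₁) (filterIso-mono p (φ⁻¹ y₁) (z , p≤z) y₁≤z))
          (subst (φ (z , p≤z) ≤_) (filterIso-inv₁ p y₂) (filterIso-mono p (z , p≤z) (φ⁻¹ y₂) z≤y₂))
        where
        p≤z = ≤.trans (proj₂ (φ⁻¹ y₁)) y₁≤z
      ... | inj₁ ≡y₁ = inj₁ (trans (sym (filterIso-inv₂ p (z , _))) (cong (λ w → proj₁ (φ⁻¹ w)) ≡y₁))
      ... | inj₂ ≡y₂ = inj₂ (trans (sym (filterIso-inv₂ p (z , _))) (cong (λ w → proj₁ (φ⁻¹ w)) ≡y₂))

-- The elements of rank at most K

record Enumeration (Member : A → Set) : Set where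
  field
    size         : ℕ
    elem         : Fin size → A
    elem-member  : ∀ i → Member (elem i)
    index        : ∀ {x} → Member x → Fin size
    elem-index   : ∀ {x} (mx : Member x) → elem (index mx) ≡ x
    elem-injective : ∀ {i j} → elem i ≡ elem j → i ≡ j

lookup-injective : (xs : List A) → Unique xs → ∀ i j → lookup xs i ≡ lookup xs j → i ≡ j
lookup-injective (x ∷ xs) (x∉ ∷ xs!) Fin.zero Fin.zero _ = refl
lookup-injective (x ∷ xs) (x∉ ∷ xs!) Fin.zero (Fin.suc j) x≡ = ⊥-elim (All.lookup x∉ (∈-lookup j) x≡)
lookup-injective (x ∷ xs) (x∉ ∷ xs!) (Fin.suc i) Fin.zero ≡x = ⊥-elim (All.lookup x∉ (∈-lookup i) (sym ≡x))
lookup-injective (x ∷ xs) (x∉ ∷ xs!) (Fin.suc i) (Fin.suc j) ≡ = cong Fin.suc (lookup-injective xs xs! i j ≡)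

module _ {A : Set} {Member : A → Set} (_≟_ : ∀ {x y} → Member x → Member y → Dec (x ≡ y)) where

  private
    _∈?_ : ∀ {x} → Member x → ∀ {ys} → All Member ys → Dec (x ∈ ys)
    mx ∈? [] = no λ ()
    mx ∈? (my ∷ mys) with mx ≟ my | mx ∈? mys
    ... | yes x≡y | _       = yes (here x≡y)
    ... | no _    | yes x∈ys = yes (there x∈ys)
    ... | no x≢y  | no x∉ys = no λ { (here x≡y) → x≢y x≡y ; (there x∈ys) → x∉ys x∈ys }

    ∉⇒All≢ : ∀ {x : A} (ys : List A) → x ∉ ys → All (λ y → ¬ x ≡ y) ys
    ∉⇒All≢ [] _ = []
    ∉⇒All≢ (y ∷ ys) x∉ = (λ x≡y → x∉ (here x≡y)) ∷ ∉⇒All≢ ys (λ x∈ → x∉ (there x∈))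

  record Deduplication (xs : List A) : Set where
    field
      list     : List A
      unique   : Unique list
      members  : All Member list
      ⊆list    : ∀ {x} → x ∈ xs → x ∈ list

  deduplicate : ∀ {xs} → All Member xs → Deduplication xs
  deduplicate [] = record { list = [] ; unique = [] ; members = [] ; ⊆list = λ () }
  deduplicate {x ∷ xs} (mx ∷ mxs) with deduplicate mxs
  ... | record { list = ys ; unique = ys! ; members = mys ; ⊆list = ⊆ys } with mx ∈? mys
  ...   | yes x∈ys = record
          { list = ys ; unique = ys! ; members = mys
          ; ⊆list = λ { (here refl) → x∈ys ; (there z∈) → ⊆ys z∈ } }
  ...   | no x∉ys = record
          { list = x ∷ ys ; unique = ∉⇒All≢ ys x∉ys ∷ ys! ; members = mx ∷ mys
          ; ⊆list = λ { (here refl) → here refl ; (there z∈) → there (⊆ys z∈) } }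

  enumerate : (xs : List A) → (∀ {x} → Member x → x ∈ xs) → All Member xs → Enumeration Member
  enumerate xs complete mxs = record
    { size = length list
    ; elem = lookup list
    ; elem-member = λ i → All.lookup members (∈-lookup i)
    ; index = λ mx → Any.index (⊆list (complete mx))
    ; elem-index = λ mx → sym (lookup-index (⊆list (complete mx)))
    ; elem-injective = lookup-injective list unique _ _
    }
    where open Deduplication (deduplicate mxs)

-- rankLevel may list an element more than once, hence the deduplication.
levels : (U : UphoLattice) → ℕ → List (UphoLattice.P U)
levels U K = concatMap (UphoLattice.rankLevel U) (upTo (suc K))

record FiniteTruncation (U : UphoLattice) (K : ℕ) : Set where
  open UphoLattice U
  field
    enumeration : Enumeration (λ x → ρ x ℕ.≤ K)
  open Enumeration enumeration renaming (size to N) public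
  field
    _≼?_    : ∀ i j → Dec (elem i ≤ elem j)
    inCore? : ∀ i → Dec (elem i ≤ coreTop)

module _ (U : UphoLattice) (K : ℕ) where

  open UphoLattice U
  open UphoLatticeProperties U

  ∈-levels : ∀ {x} → ρ x ℕ.≤ K → x ∈ levels U K
  ∈-levels {x} ρx≤K = ∈-concat⁺′ (rankLevel-complete x) (∈-map⁺ rankLevel (∈-upTo⁺ (s≤s ρx≤K)))

  levels-ρ≤ : ∀ {x} → x ∈ levels U K → ρ x ℕ.≤ K
  levels-ρ≤ {x} x∈ with ∈-concat⁻′ (map rankLevel (upTo (suc K))) x∈
  ... | _ , x∈level , level∈ with ∈-map⁻ rankLevel level∈
  ...   | r , r∈ , refl = subst (ℕ._≤ K) (sym (rankLevel-sound r x x∈level)) (ℕₚ.≤-pred (∈-upTo⁻ r∈))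

  truncate : (∀ {x y} → x ∈ coreTop ∷ levels U K → y ∈ coreTop ∷ levels U K → Dec (x ≤ y)) →
             FiniteTruncation U K
  truncate decide-≤ = record
    { enumeration = enumeration
    ; _≼?_ = λ i j → decide-≤ (there (∈-levels (elem-member i))) (there (∈-levels (elem-member j)))
    ; inCore? = λ i → decide-≤ (there (∈-levels (elem-member i))) (here refl)
    }
    where
    decide-≡ : ∀ {x y} → ρ x ℕ.≤ K → ρ y ℕ.≤ K → Dec (x ≡ y)
    decide-≡ ρx≤K ρy≤K with decide-≤ (there (∈-levels ρx≤K)) (there (∈-levels ρy≤K))
                          | decide-≤ (there (∈-levels ρy≤K)) (there (∈-levels ρx≤K))
    ... | yes x≤y | yes y≤x = yes (≤.antisym x≤y y≤x)
    ... | no x≰y  | _       = no λ { refl → x≰y ≤.refl }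
    ... | yes _   | no y≰x  = no λ { refl → y≰x ≤.refl }
    enumeration = enumerate decide-≡ (levels U K) ∈-levels (All.tabulate levels-ρ≤)
    open Enumeration enumeration

module Truncation (L : FiniteGradedLattice) (U : UphoLattice) (iso : CoreIso L U) (K : ℕ)
                  (T : FiniteTruncation U K) where

  open UphoLattice U
  open UphoLatticeProperties U
  module L = FiniteGradedLatticeProperties L
  module I = CoreIso iso
  open FiniteTruncation T

  rank : Fin N → ℕ
  rank i = ρ (elem i)

  infix 4 _≼_
  _≼_ : Fin N → Fin N → Set
  i ≼ j = elem i ≤ elem j

  private
    ρ-bot≤K : ρ bot ℕ.≤ K
    ρ-bot≤K = subst (ℕ._≤ K) (sym ρ-bot) z≤n

  b₀ : Fin N
  b₀ = index ρ-bot≤K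

  elem-b₀ : elem b₀ ≡ bot
  elem-b₀ = elem-index ρ-bot≤K

  rank-b₀ : rank b₀ ≡ 0
  rank-b₀ = trans (cong ρ elem-b₀) ρ-bot

  b₀≼ : ∀ i → b₀ ≼ i
  b₀≼ i = subst (_≤ elem i) (sym elem-b₀) (bot-min (elem i))

  rank≡0⇒b₀ : ∀ i → rank i ≡ 0 → i ≡ b₀
  rank≡0⇒b₀ i rank≡0 with i Fin.≟ b₀
  ... | yes i≡b₀ = i≡b₀
  ... | no i≢b₀ = ⊥-elim (ℕₚ.<-irrefl (sym (trans rank≡0 (sym rank-b₀)))
                           (ρ-< (b₀≼ i) (λ b₀≡i → i≢b₀ (elem-injective (sym b₀≡i)))))

  _≺?_ : ∀ i j → Dec (Lt _≤_ (elem i) (elem j))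
  i ≺? j with i ≼? j | i Fin.≟ j
  ... | yes i≼j | no i≢j   = yes (i≼j , λ ≡ → i≢j (elem-injective ≡))
  ... | yes _   | yes refl = no λ { (_ , ≢) → ≢ refl }
  ... | no i⋠j  | _        = no λ { (i≼j , _) → i⋠j i≼j }

  covers-below : ∀ i j → i ≼ j → ¬ i ≡ j → Σ (Fin N) λ c → i ≼ c × Covers _≤_ (elem c) (elem j)
  covers-below i j i≼j i≢j
    with maximal (λ c → (i ≼? c) ×-dec (c ≺? j)) rank (allFin N) (≤.refl , i≼j , λ ≡ → i≢j (elem-injective ≡))
  ... | c , (i≼c , c≺j) , c-max = c , i≼c , c≺j , nothing-between
    where
    nothing-between : ∀ z → elem c ≤ z → z ≤ elem j → (z ≡ elem c) ⊎ (z ≡ elem j)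
    nothing-between z c≤z z≤j = compare (index ρz≤K) (elem-index ρz≤K)
      where
      ρz≤K = ℕₚ.≤-trans (ρ-mono z≤j) (elem-member j)
      compare : ∀ k → elem k ≡ z → (z ≡ elem c) ⊎ (z ≡ elem j)
      compare k refl with k Fin.≟ c | k Fin.≟ j
      ... | yes refl | _        = inj₁ refl
      ... | no _     | yes refl = inj₂ refl
      ... | no k≢c   | no k≢j   = ⊥-elim (ℕₚ.<-irrefl refl (ℕₚ.<-≤-trans
            (ρ-< c≤z (λ ≡ → k≢c (elem-injective (sym ≡))))
            (c-max (∈-allFin k) (≤.trans i≼c c≤z , z≤j , λ ≡ → k≢j (elem-injective ≡)))))

  module _ (i : Fin N) (Q : Fin N → Set) (Q-base : Q i)
           (Q-step : ∀ c j → i ≼ c → Covers _≤_ (elem c) (elem j) → Q c → Q j) where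

    private
      go : ∀ f j → rank j ℕ.< f → i ≼ j → Q j
      go (suc f) j rank<f i≼j with i Fin.≟ j
      ... | yes refl = Q-base
      ... | no i≢j with covers-below i j i≼j i≢j
      ...   | c , i≼c , c⋖j = Q-step c j i≼c c⋖j (go f c rank-c<f i≼c)
        where
        rank-c<f : rank c ℕ.< f
        rank-c<f = ℕₚ.<-≤-trans (subst (rank c ℕ.<_) (sym (ρ-cover _ _ c⋖j)) (ℕₚ.n<1+n _)) (ℕₚ.≤-pred rank<f)

    cover-induction : ∀ j → i ≼ j → Q j
    cover-induction j = go (suc (rank j)) j (ℕₚ.n<1+n _)

  private
    AtomBelow : Fin N → Set
    AtomBelow j = (j ≡ b₀) ⊎ (Σ P λ s → s ∈ atoms × s ≤ elem j)

    atom-below-step : ∀ c j → b₀ ≼ c → Covers _≤_ (elem c) (elem j) → AtomBelow c → AtomBelow j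
    atom-below-step c j _ c⋖j (inj₁ refl) =
      inj₂ (elem j , subst (λ r → elem j ∈ rankLevel r) (trans (ρ-cover _ _ c⋖j) (cong suc rank-b₀))
                       (rankLevel-complete (elem j)) , ≤.refl)
    atom-below-step c j _ c⋖j (inj₂ (s , s∈ , s≤c)) = inj₂ (s , s∈ , ≤.trans s≤c (proj₁ (proj₁ c⋖j)))

  atom-below : ∀ j → ¬ j ≡ b₀ → Σ P λ s → s ∈ atoms × s ≤ elem j
  atom-below j j≢b₀ with cover-induction b₀ AtomBelow (inj₁ refl) atom-below-step j (b₀≼ j)
  ... | inj₁ j≡b₀ = ⊥-elim (j≢b₀ j≡b₀)
  ... | inj₂ below = below

  ρ-filterIso : ∀ p x (p≼x : p ≼ x) → ρ (filterIso (elem p) (elem x , p≼x)) ℕ.+ rank p ≡ rank x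
  ρ-filterIso p x p≼x = cover-induction p RankShift base step x p≼x p≼x
    where
    RankShift : Fin N → Set
    RankShift x = (p≼x : p ≼ x) → ρ (filterIso (elem p) (elem x , p≼x)) ℕ.+ rank p ≡ rank x
    base : RankShift p
    base p≼p = cong (ℕ._+ rank p) (trans (cong ρ (filterIso-bot (elem p) p≼p)) ρ-bot)
    step : ∀ c j → p ≼ c → Covers _≤_ (elem c) (elem j) → RankShift c → RankShift j
    step c j p≼c c⋖j shift-c p≼j = begin
      ρ (filterIso (elem p) (elem j , p≼j)) ℕ.+ rank p
        ≡⟨ cong (ℕ._+ rank p) (ρ-cover _ _ (filterIso-cover (elem p) (elem c , p≼c) (elem j , p≼j) c⋖j)) ⟩
      suc (ρ (filterIso (elem p) (elem c , p≼c)) ℕ.+ rank p)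
        ≡⟨ cong suc (shift-c p≼c) ⟩
      suc (rank c)
        ≡⟨ ρ-cover _ _ c⋖j ⟨
      rank j ∎
      where open ≡-Reasoning

  ρ-filterIso⁻¹ : ∀ p y → ρ (proj₁ (filterIso⁻¹ p (elem y))) ≡ rank y ℕ.+ ρ p
  ρ-filterIso⁻¹ p y = cover-induction b₀ RankShift base step y (b₀≼ y)
    where
    RankShift : Fin N → Set
    RankShift y = ρ (proj₁ (filterIso⁻¹ p (elem y))) ≡ rank y ℕ.+ ρ p
    base : RankShift b₀
    base = begin
      ρ (proj₁ (filterIso⁻¹ p (elem b₀)))  ≡⟨ cong (λ z → ρ (proj₁ (filterIso⁻¹ p z))) elem-b₀ ⟩
      ρ (proj₁ (filterIso⁻¹ p bot))        ≡⟨ cong ρ (filterIso⁻¹-bot p) ⟩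
      ρ p                                  ≡⟨ cong (ℕ._+ ρ p) rank-b₀ ⟨
      rank b₀ ℕ.+ ρ p                      ∎
      where open ≡-Reasoning
    step : ∀ c j → b₀ ≼ c → Covers _≤_ (elem c) (elem j) → RankShift c → RankShift j
    step c j _ c⋖j shift-c = begin
      ρ (proj₁ (filterIso⁻¹ p (elem j)))      ≡⟨ ρ-cover _ _ (filterIso⁻¹-cover p (elem c) (elem j) c⋖j) ⟩
      suc (ρ (proj₁ (filterIso⁻¹ p (elem c)))) ≡⟨ cong suc shift-c ⟩
      suc (rank c ℕ.+ ρ p)                    ≡⟨ cong (ℕ._+ ρ p) (ρ-cover _ _ c⋖j) ⟨
      rank j ℕ.+ ρ p                          ∎
      where open ≡-Reasoning

  toCore : Fin L.n → P
  toCore l = proj₁ (I.to l)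

  from-cong : ∀ c c′ → proj₁ c ≡ proj₁ c′ → I.from c ≡ I.from c′
  from-cong c c′ c≡c′ = L.≤.antisym
    (I.to-refl _ _ (≤.reflexive (trans (I.to-from c) (trans c≡c′ (sym (I.to-from c′))))))
    (I.to-refl _ _ (≤.reflexive (trans (I.to-from c′) (trans (sym c≡c′) (sym (I.to-from c))))))

  toCore-bot : toCore L.bot ≡ bot
  toCore-bot = ≤.antisym
    (subst (toCore L.bot ≤_) (I.to-from (bot , bot-min coreTop)) (I.to-mono _ _ (L.bot-min (I.from (bot , bot-min coreTop)))))
    (bot-min _)

  toCore-cover : ∀ c l → Covers L._≤_ c l → Covers _≤_ (toCore c) (toCore l)
  toCore-cover c l ((c≤l , c≢l) , nothing-between) = (I.to-mono c l c≤l , ≢′) , between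
    where
    ≢′ : ¬ toCore c ≡ toCore l
    ≢′ ≡′ = c≢l (trans (sym (I.from-to c)) (trans (from-cong (I.to c) (I.to l) ≡′) (I.from-to l)))
    between : ∀ z → toCore c ≤ z → z ≤ toCore l → (z ≡ toCore c) ⊎ (z ≡ toCore l)
    between z c≤z z≤l with nothing-between (I.from (z , z≤top))
        (I.to-refl _ _ (subst (toCore c ≤_) (sym (I.to-from (z , z≤top))) c≤z))
        (I.to-refl _ _ (subst (_≤ toCore l) (sym (I.to-from (z , z≤top))) z≤l))
      where
      z≤top = ≤.trans z≤l (proj₂ (I.to l))
    ... | inj₁ ≡c = inj₁ (trans (sym (I.to-from (z , _))) (cong toCore ≡c))
    ... | inj₂ ≡l = inj₂ (trans (sym (I.to-from (z , _))) (cong toCore ≡l))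

  ρ-toCore : ∀ l → ρ (toCore l) ≡ L.ρ l
  ρ-toCore l = go (suc (L.#below l)) l (ℕₚ.n<1+n _)
    where
    go : ∀ f l → L.#below l ℕ.< f → ρ (toCore l) ≡ L.ρ l
    go (suc f) l #l<f with l Fin.≟ L.bot
    ... | yes refl = trans (cong ρ toCore-bot) (trans ρ-bot (sym L.ρ-bot))
    ... | no l≢bot with L.covers-some l l≢bot
    ...   | c , c⋖l = begin
      ρ (toCore l)        ≡⟨ ρ-cover _ _ (toCore-cover c l c⋖l) ⟩
      suc (ρ (toCore c))  ≡⟨ cong suc (go f c (ℕₚ.<-≤-trans (L.#below-mono (proj₁ c⋖l)) (ℕₚ.≤-pred #l<f))) ⟩
      suc (L.ρ c)         ≡⟨ L.ρ-cover c l c⋖l ⟨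
      L.ρ l               ∎
      where open ≡-Reasoning

  fromL : Fin L.n → Fin N
  fromL l with ρ (toCore l) ℕ.≤? K
  ... | yes ρ≤K = index ρ≤K
  ... | no _ = b₀

  elem-fromL : ∀ l → ρ (toCore l) ℕ.≤ K → elem (fromL l) ≡ toCore l
  elem-fromL l ρ≤K with ρ (toCore l) ℕ.≤? K
  ... | yes ρ≤K′ = elem-index ρ≤K′
  ... | no ρ≰K = ⊥-elim (ρ≰K ρ≤K)

  toL : Fin N → Fin L.n
  toL i with inCore? i
  ... | yes i∈core = I.from (elem i , i∈core)
  ... | no _ = L.bot

  toCore-toL : ∀ i → elem i ≤ coreTop → toCore (toL i) ≡ elem i
  toCore-toL i i∈core with inCore? i
  ... | yes i∈core′ = I.to-from (elem i , i∈core′)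
  ... | no i∉core = ⊥-elim (i∉core i∈core)

  toL-fromL : ∀ l → ρ (toCore l) ℕ.≤ K → toL (fromL l) ≡ l
  toL-fromL l ρ≤K with inCore? (fromL l)
  ... | yes in-core = trans (from-cong (elem (fromL l) , in-core) (I.to l) (elem-fromL l ρ≤K)) (I.from-to l)
  ... | no not-in-core = ⊥-elim (not-in-core (subst (_≤ coreTop) (sym (elem-fromL l ρ≤K)) (proj₂ (I.to l))))

  fromL-toL : ∀ i → elem i ≤ coreTop → fromL (toL i) ≡ i
  fromL-toL i i∈core = elem-injective (trans (elem-fromL (toL i) ρ≤K) (toCore-toL i i∈core))
    where
    ρ≤K = subst (λ z → ρ z ℕ.≤ K) (sym (toCore-toL i i∈core)) (elem-member i)

  ∑-core : {PL : Fin L.n → Set} {PM : Fin N → Set} (PL? : Decidable PL) (PM? : Decidable PM) (f : Fin L.n → ℤ) →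
           (∀ {l} → PL l → ρ (toCore l) ℕ.≤ K) →
           (∀ {l} → PL l → PM (fromL l)) →
           (∀ {i} → elem i ≤ coreTop → PM i → PL (toL i)) →
           ∑[ l ∈ allFin L.n ] when (PL? l) (f l) ≡ ∑[ i ∈ allFin N ] when (PM? i) (when (inCore? i) (f (toL i)))
  ∑-core {PL} {PM} PL? PM? f ρ≤K PL⇒PM PM⇒PL =
    trans (∑-reindex Fin._≟_ Fin._≟_ (allFin⁺ L.n) (allFin⁺ N) PL? (λ i → PM? i ×-dec inCore? i) correspondence
                     f (λ i → f (toL i)) (λ _ pl → cong f (sym (toL-fromL _ (ρ≤K pl)))))
          (∑-cong (allFin N) (λ i → sym (when-×-dec (PM? i) (inCore? i) (f (toL i)))))
    where
    correspondence : Correspondence (allFin L.n) PL (allFin N) (λ i → PM i × elem i ≤ coreTop)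
    correspondence = record
      { to = fromL
      ; from = toL
      ; to-∈ = λ {l} _ _ → ∈-allFin (fromL l)
      ; to-Q = λ {l} _ pl → PL⇒PM pl , subst (_≤ coreTop) (sym (elem-fromL l (ρ≤K pl))) (proj₂ (I.to l))
      ; from-∈ = λ {i} _ _ → ∈-allFin (toL i)
      ; from-P = λ { _ (pm , i∈core) → PM⇒PL i∈core pm }
      ; from∘to = λ _ pl → toL-fromL _ (ρ≤K pl)
      ; to∘from = λ { _ (_ , i∈core) → fromL-toL _ i∈core }
      }

  ν : Fin N → ℤ
  ν i = when (inCore? i) (L.mobius (toL i))

  χ-expansion : L.chiStar ≈[ K ] ∑ˢ[ i ∈ allFin N ] ν i ·ˢ X^ rank i
  χ-expansion r r≤K = begin
    L.chiStar r
      ≡⟨ ∑-filter (λ l → L.ρ l ℕ.≟ r) (allFin L.n) L.mobius ⟩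
    ∑[ l ∈ allFin L.n ] when (L.ρ l ℕ.≟ r) (L.mobius l)
      ≡⟨ ∑-core (λ l → L.ρ l ℕ.≟ r) (λ i → rank i ℕ.≟ r) L.mobius ρ≤K fromL-rank toL-rank ⟩
    ∑[ i ∈ allFin N ] when (rank i ℕ.≟ r) (ν i)
      ≡⟨ ∑-cong (allFin N) (λ i → *-when1 (rank i ℕ.≟ r) (ν i)) ⟨
    ∑[ i ∈ allFin N ] ν i * when (rank i ℕ.≟ r) 1ℤ ∎
    where
    open ≡-Reasoning
    ρ≤K : ∀ {l} → L.ρ l ≡ r → ρ (toCore l) ℕ.≤ K
    ρ≤K {l} ρl≡r = subst (ℕ._≤ K) (sym (trans (ρ-toCore l) ρl≡r)) r≤K
    fromL-rank : ∀ {l} → L.ρ l ≡ r → rank (fromL l) ≡ r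
    fromL-rank {l} ρl≡r = trans (cong ρ (elem-fromL l (ρ≤K ρl≡r))) (trans (ρ-toCore l) ρl≡r)
    toL-rank : ∀ {i} → elem i ≤ coreTop → rank i ≡ r → L.ρ (toL i) ≡ r
    toL-rank {i} i∈core rank≡r = trans (sym (ρ-toCore (toL i))) (trans (cong ρ (toCore-toL i i∈core)) rank≡r)

  module _ (q : Fin N) where

    private
      q∧top : P
      q∧top = elem q ∧ coreTop

      q∧top≤q : q∧top ≤ elem q
      q∧top≤q = proj₁ (≤.infimum (elem q) coreTop)

      q∧top≤top : q∧top ≤ coreTop
      q∧top≤top = proj₁ (proj₂ (≤.infimum (elem q) coreTop))

      ≤q∧top : ∀ z → z ≤ elem q → z ≤ coreTop → z ≤ q∧top
      ≤q∧top = proj₂ (proj₂ (≤.infimum (elem q) coreTop))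

    coreMeet : Fin L.n
    coreMeet = I.from (q∧top , q∧top≤top)

    private
      toCore-coreMeet : toCore coreMeet ≡ q∧top
      toCore-coreMeet = I.to-from (q∧top , q∧top≤top)

      toCore≤q : ∀ {l} → l L.≤ coreMeet → toCore l ≤ elem q
      toCore≤q l≤ = ≤.trans (subst (_ ≤_) toCore-coreMeet (I.to-mono _ _ l≤)) q∧top≤q

      ρ-toCore≤K : ∀ {l} → l L.≤ coreMeet → ρ (toCore l) ℕ.≤ K
      ρ-toCore≤K l≤ = ℕₚ.≤-trans (ρ-mono (toCore≤q l≤)) (elem-member q)

      fromL-≼ : ∀ {l} → l L.≤ coreMeet → fromL l ≼ q
      fromL-≼ {l} l≤ = subst (_≤ elem q) (sym (elem-fromL l (ρ-toCore≤K l≤))) (toCore≤q l≤)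

      toL-≤ : ∀ {p} → elem p ≤ coreTop → p ≼ q → toL p L.≤ coreMeet
      toL-≤ {p} p∈core p≼q = I.to-refl _ _
        (subst₂ _≤_ (sym (toCore-toL p p∈core)) (sym toCore-coreMeet) (≤q∧top (elem p) p≼q p∈core))

    coreMeet≡bot⇒q≡b₀ : coreMeet ≡ L.bot → q ≡ b₀
    coreMeet≡bot⇒q≡b₀ coreMeet≡bot with q Fin.≟ b₀
    ... | yes q≡b₀ = q≡b₀
    ... | no q≢b₀ with atom-below q q≢b₀
    ...   | s , s∈atoms , s≤q = ⊥-elim (ℕₚ.1+n≢0 (trans (sym (rankLevel-sound 1 s s∈atoms)) (trans (cong ρ s≡bot) ρ-bot)))
      where
      q∧top≡bot : q∧top ≡ bot
      q∧top≡bot = trans (sym toCore-coreMeet) (trans (cong toCore coreMeet≡bot) toCore-bot)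
      s≡bot : s ≡ bot
      s≡bot = ≤.antisym (subst (s ≤_) q∧top≡bot (≤q∧top s s≤q (atom≤coreTop s∈atoms))) (bot-min s)

    q≡b₀⇒coreMeet≡bot : q ≡ b₀ → coreMeet ≡ L.bot
    q≡b₀⇒coreMeet≡bot refl =
      trans (from-cong (q∧top , q∧top≤top) (I.to L.bot) (trans q∧top≡bot (sym toCore-bot))) (I.from-to L.bot)
      where
      q∧top≡bot : q∧top ≡ bot
      q∧top≡bot = ≤.antisym (subst (q∧top ≤_) elem-b₀ q∧top≤q) (bot-min _)

    ∑-ν-≼ : ∑[ p ∈ allFin N ] when (p ≼? q) (ν p) ≡ when (q Fin.≟ b₀) 1ℤ
    ∑-ν-≼ = begin
      ∑[ p ∈ allFin N ] when (p ≼? q) (ν p)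
        ≡⟨ ∑-core (λ l → l L.≤? coreMeet) (_≼? q) L.mobius ρ-toCore≤K fromL-≼ toL-≤ ⟨
      ∑[ l ∈ allFin L.n ] when (l L.≤? coreMeet) (L.mobius l)
        ≡⟨ L.∑-mobius-≤ coreMeet ⟩
      when (coreMeet Fin.≟ L.bot) 1ℤ
        ≡⟨ when-cong (coreMeet Fin.≟ L.bot) (q Fin.≟ b₀) coreMeet≡bot⇒q≡b₀ q≡b₀⇒coreMeet≡bot (λ _ → refl) ⟩
      when (q Fin.≟ b₀) 1ℤ ∎
      where open ≡-Reasoning

  ∑-ν-inversion : {B : Set} (ys : List B) (top : B → Fin N) (g : B → Series) →
    ∑ˢ[ p ∈ allFin N ] ν p ·ˢ (∑ˢ[ y ∈ ys ] when (p ≼? top y) 1ℤ ·ˢ g y) ≐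
    ∑ˢ[ y ∈ ys ] when (top y Fin.≟ b₀) 1ℤ ·ˢ g y
  ∑-ν-inversion ys top g j = begin
    ∑[ p ∈ allFin N ] ν p * (∑[ y ∈ ys ] when (p ≼? top y) 1ℤ * g y j)
      ≡⟨ ∑-cong (allFin N) (λ p → ∑-*ˡ ys (ν p) (λ y → when (p ≼? top y) 1ℤ * g y j)) ⟩
    ∑[ p ∈ allFin N ] ∑[ y ∈ ys ] ν p * (when (p ≼? top y) 1ℤ * g y j)
      ≡⟨ ∑-swap (allFin N) ys (λ p y → ν p * (when (p ≼? top y) 1ℤ * g y j)) ⟩
    ∑[ y ∈ ys ] ∑[ p ∈ allFin N ] ν p * (when (p ≼? top y) 1ℤ * g y j)
      ≡⟨ ∑-cong ys (λ y → ∑-cong (allFin N) (λ p → regroup (p ≼? top y) (ν p) (g y j))) ⟩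
    ∑[ y ∈ ys ] ∑[ p ∈ allFin N ] when (p ≼? top y) (ν p) * g y j
      ≡⟨ ∑-cong ys (λ y → ∑-*ʳ (allFin N) (g y j) (λ p → when (p ≼? top y) (ν p))) ⟨
    ∑[ y ∈ ys ] (∑[ p ∈ allFin N ] when (p ≼? top y) (ν p)) * g y j
      ≡⟨ ∑-cong ys (λ y → cong (_* g y j) (∑-ν-≼ (top y))) ⟩
    ∑[ y ∈ ys ] when (top y Fin.≟ b₀) 1ℤ * g y j ∎
    where
    open ≡-Reasoning
    regroup : ∀ {Q : Set} (d : Dec Q) c z → c * (when d 1ℤ * z) ≡ when d c * z
    regroup d c z = trans (cong (c *_) (when1-* d z)) (trans (when-*ˡ d c z) (sym (when-*ʳ d c z)))

  F : Series
  F = ∑ˢ[ y ∈ allFin N ] X^ rank y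

  F-constant : F 0 ≡ 1ℤ
  F-constant = begin
    ∑[ y ∈ allFin N ] when (rank y ℕ.≟ 0) 1ℤ
      ≡⟨ ∑-cong (allFin N) (λ y → when-cong (rank y ℕ.≟ 0) (y Fin.≟ b₀) (rank≡0⇒b₀ y) (λ { refl → rank-b₀ }) (λ _ → refl)) ⟩
    ∑[ y ∈ allFin N ] when (y Fin.≟ b₀) 1ℤ
      ≡⟨ ∑-delta Fin._≟_ (allFin N) b₀ (λ _ → 1ℤ) (allFin⁺ N) (∈-allFin b₀) ⟩
    1ℤ ∎
    where open ≡-Reasoning

  up : Fin N → Series
  up p = ∑ˢ[ x ∈ allFin N ] when (p ≼? x) 1ℤ ·ˢ X^ rank x

  module _ (p : Fin N) where

    private
      ψ : Fin N → P
      ψ y = proj₁ (filterIso⁻¹ (elem p) (elem y))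

      ρ-φ≤K : ∀ x (p≼x : p ≼ x) → ρ (filterIso (elem p) (elem x , p≼x)) ℕ.≤ K
      ρ-φ≤K x p≼x = ℕₚ.≤-trans (ℕₚ.m≤m+n _ _) (ℕₚ.≤-trans (ℕₚ.≤-reflexive (ρ-filterIso p x p≼x)) (elem-member x))

      shift-down : Fin N → Fin N
      shift-down x with p ≼? x
      ... | yes p≼x = index (ρ-φ≤K x p≼x)
      ... | no _ = b₀

      elem-shift-down : ∀ x (p≼x : p ≼ x) → elem (shift-down x) ≡ filterIso (elem p) (elem x , p≼x)
      elem-shift-down x p≼x with p ≼? x
      ... | yes p≼x′ = trans (elem-index (ρ-φ≤K x p≼x′)) (filterIso-cong (elem p) (elem x , p≼x′) (elem x , p≼x) refl)
      ... | no p⋠x = ⊥-elim (p⋠x p≼x)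

      shift-up : Fin N → Fin N
      shift-up y with ρ (ψ y) ℕ.≤? K
      ... | yes ρ≤K = index ρ≤K
      ... | no _ = b₀

      elem-shift-up : ∀ y → ρ (ψ y) ℕ.≤ K → elem (shift-up y) ≡ ψ y
      elem-shift-up y ρ≤K with ρ (ψ y) ℕ.≤? K
      ... | yes ρ≤K′ = elem-index ρ≤K′
      ... | no ρ≰K = ⊥-elim (ρ≰K ρ≤K)

      ρ-ψ-shift-down : ∀ {x} (p≼x : p ≼ x) → ρ (ψ (shift-down x)) ≡ rank x
      ρ-ψ-shift-down {x} p≼x = trans (ρ-filterIso⁻¹ (elem p) (shift-down x))
        (trans (cong (λ z → ρ z ℕ.+ rank p) (elem-shift-down x p≼x)) (ρ-filterIso p x p≼x))

      shift-up∘shift-down : ∀ {x} → p ≼ x → shift-up (shift-down x) ≡ x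
      shift-up∘shift-down {x} p≼x = elem-injective (begin
        elem (shift-up (shift-down x))
          ≡⟨ elem-shift-up (shift-down x) (subst (ℕ._≤ K) (sym (ρ-ψ-shift-down p≼x)) (elem-member x)) ⟩
        ψ (shift-down x)
          ≡⟨ cong (λ z → proj₁ (filterIso⁻¹ (elem p) z)) (elem-shift-down x p≼x) ⟩
        proj₁ (filterIso⁻¹ (elem p) (filterIso (elem p) (elem x , p≼x)))
          ≡⟨ filterIso-inv₂ (elem p) (elem x , p≼x) ⟩
        elem x ∎)
        where open ≡-Reasoning

      shift-down∘shift-up : ∀ {y} (ρψ≤K : ρ (ψ y) ℕ.≤ K) (p≼ : p ≼ shift-up y) → shift-down (shift-up y) ≡ y
      shift-down∘shift-up {y} ρψ≤K p≼ = elem-injective (begin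
        elem (shift-down (shift-up y))
          ≡⟨ elem-shift-down (shift-up y) p≼ ⟩
        filterIso (elem p) (elem (shift-up y) , p≼)
          ≡⟨ filterIso-cong (elem p) _ (filterIso⁻¹ (elem p) (elem y)) (elem-shift-up y ρψ≤K) ⟩
        filterIso (elem p) (filterIso⁻¹ (elem p) (elem y))
          ≡⟨ filterIso-inv₁ (elem p) (elem y) ⟩
        elem y ∎)
        where open ≡-Reasoning

    module _ (r : ℕ) (r≤K : r ℕ.≤ K) (p≤r : rank p ℕ.≤ r) where

      private
        ρ-ψ : ∀ {y} → rank y ≡ r ∸ rank p → ρ (ψ y) ≡ r
        ρ-ψ {y} rank≡ = trans (ρ-filterIso⁻¹ (elem p) y) (trans (cong (ℕ._+ rank p) rank≡) (ℕₚ.m∸n+n≡m p≤r))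

        ρ-ψ≤K : ∀ {y} → rank y ≡ r ∸ rank p → ρ (ψ y) ℕ.≤ K
        ρ-ψ≤K rank≡ = subst (ℕ._≤ K) (sym (ρ-ψ rank≡)) r≤K

        p≼shift-up : ∀ {y} → rank y ≡ r ∸ rank p → p ≼ shift-up y
        p≼shift-up {y} rank≡ =
          subst (elem p ≤_) (sym (elem-shift-up y (ρ-ψ≤K rank≡))) (proj₂ (filterIso⁻¹ (elem p) (elem y)))

      filter-shift : Correspondence (allFin N) (λ x → p ≼ x × rank x ≡ r) (allFin N) (λ y → rank y ≡ r ∸ rank p)
      filter-shift = record
        { to = shift-down
        ; from = shift-up
        ; to-∈ = λ {x} _ _ → ∈-allFin (shift-down x)
        ; to-Q = λ { {x} _ (p≼x , refl) → trans (cong ρ (elem-shift-down x p≼x))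
                     (trans (sym (ℕₚ.m+n∸n≡m _ (rank p))) (cong (_∸ rank p) (ρ-filterIso p x p≼x))) }
        ; from-∈ = λ {y} _ _ → ∈-allFin (shift-up y)
        ; from-P = λ {y} _ rank≡ → p≼shift-up rank≡ , trans (cong ρ (elem-shift-up y (ρ-ψ≤K rank≡))) (ρ-ψ rank≡)
        ; from∘to = λ { _ (p≼x , _) → shift-up∘shift-down p≼x }
        ; to∘from = λ _ rank≡ → shift-down∘shift-up (ρ-ψ≤K rank≡) (p≼shift-up rank≡)
        }

    #above-of-rank : ∀ r → r ℕ.≤ K →
      ∑[ x ∈ allFin N ] when ((p ≼? x) ×-dec (rank x ℕ.≟ r)) 1ℤ ≡ when (rank p ℕ.≤? r) (F (r ∸ rank p))
    #above-of-rank r r≤K with rank p ℕ.≤? r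
    ... | no p≰r = ∑-zero (allFin N) λ {x} _ → when-no ((p ≼? x) ×-dec (rank x ℕ.≟ r))
                     λ { (p≼x , refl) → p≰r (ρ-mono p≼x) }
    ... | yes p≤r = ∑-reindex Fin._≟_ Fin._≟_ (allFin⁺ N) (allFin⁺ N)
      (λ x → (p ≼? x) ×-dec (rank x ℕ.≟ r)) (λ y → rank y ℕ.≟ r ∸ rank p) (filter-shift r r≤K p≤r)
      (λ _ → 1ℤ) (λ _ → 1ℤ) (λ _ _ → refl)

    up≈ : up p ≈[ K ] X^ rank p ⊛ F
    up≈ r r≤K = begin
      ∑[ x ∈ allFin N ] when (p ≼? x) 1ℤ * when (rank x ℕ.≟ r) 1ℤ
        ≡⟨ ∑-cong (allFin N) (λ x → trans (when1-* (p ≼? x) _) (when-×-dec (p ≼? x) (rank x ℕ.≟ r) 1ℤ)) ⟩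
      ∑[ x ∈ allFin N ] when ((p ≼? x) ×-dec (rank x ℕ.≟ r)) 1ℤ
        ≡⟨ #above-of-rank r r≤K ⟩
      when (rank p ℕ.≤? r) (F (r ∸ rank p))
        ≡⟨ X^-⊛ (rank p) F r ⟨
      (X^ rank p ⊛ F) r ∎
      where open ≡-Reasoning

  infixr 7 _⊓_
  _⊓_ : Fin N → Fin N → Fin N
  i ⊓ j = index (ℕₚ.≤-trans (ρ-mono (proj₁ (≤.infimum (elem i) (elem j)))) (elem-member i))

  ≼-⊓ : ∀ p i j → (p ≼ i × p ≼ j) → p ≼ i ⊓ j
  ≼-⊓ p i j (p≼i , p≼j) = subst (elem p ≤_) (sym (elem-index _)) (proj₂ (proj₂ (≤.infimum (elem i) (elem j))) (elem p) p≼i p≼j)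

  ⊓-≼ : ∀ p i j → p ≼ i ⊓ j → p ≼ i × p ≼ j
  ⊓-≼ p i j p≼i⊓j =
    ≤.trans p≤∧ (proj₁ (≤.infimum (elem i) (elem j))) , ≤.trans p≤∧ (proj₁ (proj₂ (≤.infimum (elem i) (elem j))))
    where
    p≤∧ = subst (elem p ≤_) (elem-index _) p≼i⊓j

  meet : ∀ {m} → Vec (Fin N) (suc m) → Fin N
  meet (x ∷ []) = x
  meet (x ∷ y ∷ t) = x ⊓ meet (y ∷ t)

  ∏-≼-meet : ∀ {m} p (t : Vec (Fin N) (suc m)) → ∏ᵛ (λ x → when (p ≼? x) 1ℤ) t ≡ when (p ≼? meet t) 1ℤ
  ∏-≼-meet p (x ∷ []) = ℤₚ.*-identityʳ _
  ∏-≼-meet p (x ∷ y ∷ t) = begin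
    when (p ≼? x) 1ℤ * ∏ᵛ (λ x → when (p ≼? x) 1ℤ) (y ∷ t)  ≡⟨ cong (when (p ≼? x) 1ℤ *_) (∏-≼-meet p (y ∷ t)) ⟩
    when (p ≼? x) 1ℤ * when (p ≼? meet (y ∷ t)) 1ℤ          ≡⟨ when1-* (p ≼? x) _ ⟩
    when (p ≼? x) (when (p ≼? meet (y ∷ t)) 1ℤ)              ≡⟨ when-×-dec (p ≼? x) (p ≼? meet (y ∷ t)) 1ℤ ⟩
    when ((p ≼? x) ×-dec (p ≼? meet (y ∷ t))) 1ℤ
      ≡⟨ when-cong ((p ≼? x) ×-dec (p ≼? meet (y ∷ t))) (p ≼? meet (x ∷ y ∷ t)) (≼-⊓ p x _) (⊓-≼ p x _) (λ _ → refl) ⟩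
    when (p ≼? meet (x ∷ y ∷ t)) 1ℤ ∎
    where open ≡-Reasoning

  χ⊛F≈one : L.chiStar ⊛ F ≈[ K ] one
  χ⊛F≈one = begin
    L.chiStar ⊛ F
      ≈⟨ ⊛-cong-≈ K χ-expansion (λ _ _ → refl) ⟩
    (∑ˢ[ p ∈ allFin N ] ν p ·ˢ X^ rank p) ⊛ F
      ≈⟨ ≐⇒≈ K (∑ˢ-·ˢ-⊛ (allFin N) ν (λ p → X^ rank p) F) ⟩
    ∑ˢ[ p ∈ allFin N ] ν p ·ˢ (X^ rank p ⊛ F)
      ≈⟨ ∑ˢ-cong-≈ (allFin N) K (λ p → ·ˢ-cong-≈ (ν p) K (λ j j≤K → sym (up≈ p j j≤K))) ⟩
    ∑ˢ[ p ∈ allFin N ] ν p ·ˢ up p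
      ≈⟨ ≐⇒≈ K (∑-ν-inversion (allFin N) (λ x → x) (λ x → X^ rank x)) ⟩
    ∑ˢ[ x ∈ allFin N ] when (x Fin.≟ b₀) 1ℤ ·ˢ X^ rank x
      ≈⟨ ≐⇒≈ K (λ j → trans (∑-cong (allFin N) (λ x → when1-* (x Fin.≟ b₀) _))
                            (∑-delta Fin._≟_ (allFin N) b₀ (λ x → (X^ rank x) j) (allFin⁺ N) (∈-allFin b₀))) ⟩
    X^ rank b₀
      ≈⟨ ≐⇒≈ K (subst (λ d → X^ d ≐ one) (sym rank-b₀) X^0≐one) ⟩
    one ∎
    where open SetoidReasoning (≈-setoid K)

  chiStar-constant : L.chiStar 0 ≡ 1ℤ
  chiStar-constant = begin
    L.chiStar 0             ≡⟨ ℤₚ.*-identityʳ _ ⟨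
    L.chiStar 0 * 1ℤ        ≡⟨ cong (L.chiStar 0 *_) F-constant ⟨
    L.chiStar 0 * F 0       ≡⟨ ℤₚ.+-identityʳ _ ⟨
    (L.chiStar ⊛ F) 0       ≡⟨ χ⊛F≈one 0 z≤n ⟩
    1ℤ                      ∎
    where open ≡-Reasoning

  module _ (m : ℕ) where

    private
      M = suc m
      numerator = substPow L.chiStar M
      denominator = L.chiStar ^ˢ M
      w : Fin N → Fin N → ℤ
      w p x = when (p ≼? x) 1ℤ

    quotient : Series
    quotient = numerator ⊛ (F ^ˢ M)

    X^⊛F^≈up^ : ∀ p → X^ (rank p ℕ.* M) ⊛ (F ^ˢ M) ≈[ K ] up p ^ˢ M
    X^⊛F^≈up^ p = begin
      X^ (rank p ℕ.* M) ⊛ (F ^ˢ M)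
        ≈⟨ ≐⇒≈ K (⊛-congˡ (F ^ˢ M) (λ j → trans (cong (λ d → (X^ d) j) (ℕₚ.*-comm (rank p) M)) (sym (X^-^ˢ (rank p) M j)))) ⟩
      (X^ rank p ^ˢ M) ⊛ (F ^ˢ M)
        ≈⟨ ≐⇒≈ K (λ j → sym (^ˢ-distrib-⊛ (X^ rank p) F M j)) ⟩
      (X^ rank p ⊛ F) ^ˢ M
        ≈⟨ ^ˢ-cong-≈ K M (λ j j≤K → sym (up≈ p j j≤K)) ⟩
      up p ^ˢ M ∎
      where open SetoidReasoning (≈-setoid K)

    quotient-expansion : quotient ≈[ K ] ∑ˢ[ t ∈ vectors (allFin N) M ] when (meet t Fin.≟ b₀) 1ℤ ·ˢ X^ ∑ᵛ rank t
    quotient-expansion = begin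
      numerator ⊛ (F ^ˢ M)
        ≈⟨ ⊛-cong-≈ K (substPow-cong-≈ K M χ-expansion) (λ _ _ → refl) ⟩
      substPow (∑ˢ[ p ∈ allFin N ] ν p ·ˢ X^ rank p) M ⊛ (F ^ˢ M)
        ≈⟨ ≐⇒≈ K (⊛-congˡ (F ^ˢ M) (substPow-∑ˢ (allFin N) ν rank m)) ⟩
      (∑ˢ[ p ∈ allFin N ] ν p ·ˢ X^ (rank p ℕ.* M)) ⊛ (F ^ˢ M)
        ≈⟨ ≐⇒≈ K (∑ˢ-·ˢ-⊛ (allFin N) ν (λ p → X^ (rank p ℕ.* M)) (F ^ˢ M)) ⟩
      ∑ˢ[ p ∈ allFin N ] ν p ·ˢ (X^ (rank p ℕ.* M) ⊛ (F ^ˢ M))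
        ≈⟨ ∑ˢ-cong-≈ (allFin N) K (λ p → ·ˢ-cong-≈ (ν p) K (X^⊛F^≈up^ p)) ⟩
      ∑ˢ[ p ∈ allFin N ] ν p ·ˢ (up p ^ˢ M)
        ≈⟨ ≐⇒≈ K (∑ˢ-cong (allFin N) (λ p → ·ˢ-cong (ν p) (^ˢ-∑ˢ (allFin N) (w p) rank M))) ⟩
      ∑ˢ[ p ∈ allFin N ] ν p ·ˢ (∑ˢ[ t ∈ vectors (allFin N) M ] ∏ᵛ (w p) t ·ˢ X^ ∑ᵛ rank t)
        ≈⟨ ≐⇒≈ K (∑ˢ-cong (allFin N) (λ p → ·ˢ-cong (ν p) (∑ˢ-cong (vectors (allFin N) M)
             (λ t j → cong (_* (X^ ∑ᵛ rank t) j) (∏-≼-meet p t))))) ⟩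
      ∑ˢ[ p ∈ allFin N ] ν p ·ˢ (∑ˢ[ t ∈ vectors (allFin N) M ] when (p ≼? meet t) 1ℤ ·ˢ X^ ∑ᵛ rank t)
        ≈⟨ ≐⇒≈ K (∑-ν-inversion (vectors (allFin N) M) meet (λ t → X^ ∑ᵛ rank t)) ⟩
      ∑ˢ[ t ∈ vectors (allFin N) M ] when (meet t Fin.≟ b₀) 1ℤ ·ˢ X^ ∑ᵛ rank t ∎
      where open SetoidReasoning (≈-setoid K)

    quotient-nonneg : + 0 ≤ℤ quotient K
    quotient-nonneg = subst (+ 0 ≤ℤ_) (sym (quotient-expansion K ℕₚ.≤-refl))
      (∑-nonneg (vectors (allFin N) M) _ λ t → subst (+ 0 ≤ℤ_) (sym (when1-* (meet t Fin.≟ b₀) _))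
        (when-nonneg (meet t Fin.≟ b₀) (when-nonneg (∑ᵛ rank t ℕ.≟ K) (ℤ.+≤+ z≤n))))

    numerator≈denominator⊛quotient : numerator ≈[ K ] denominator ⊛ quotient
    numerator≈denominator⊛quotient = begin
      numerator
        ≈⟨ ≐⇒≈ K (λ j → sym (⊛-identityʳ numerator j)) ⟩
      numerator ⊛ one
        ≈⟨ ⊛-cong-≈ {numerator} {numerator} K (λ _ _ → refl) (λ j j≤K → sym (trans (^ˢ-cong-≈ K M χ⊛F≈one j j≤K) (one-^ˢ M j))) ⟩
      numerator ⊛ ((L.chiStar ⊛ F) ^ˢ M)
        ≈⟨ ≐⇒≈ K (⊛-congʳ numerator (^ˢ-distrib-⊛ L.chiStar F M)) ⟩
      numerator ⊛ (denominator ⊛ (F ^ˢ M))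
        ≈⟨ ≐⇒≈ K (λ j → sym (⊛-assoc numerator denominator (F ^ˢ M) j)) ⟩
      (numerator ⊛ denominator) ⊛ (F ^ˢ M)
        ≈⟨ ≐⇒≈ K (⊛-congˡ (F ^ˢ M) (⊛-comm numerator denominator)) ⟩
      (denominator ⊛ numerator) ⊛ (F ^ˢ M)
        ≈⟨ ≐⇒≈ K (⊛-assoc denominator numerator (F ^ˢ M)) ⟩
      denominator ⊛ quotient ∎
      where open SetoidReasoning (≈-setoid K)

    divSeries≡quotient : divSeries numerator denominator K ≡ quotient K
    divSeries≡quotient = divSeries-unique K numerator denominator quotient
      (^ˢ-constant L.chiStar M chiStar-constant) numerator≈denominator⊛quotient

¬¬-decide-all : (xs : List A) (R : A → A → Set) → ¬ ¬ All (λ x → All (λ y → Dec (R x y)) xs) xs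
¬¬-decide-all xs R =
  All.sequenceM 0ℓ ¬¬-Monad (All.tabulate λ _ → All.sequenceM 0ℓ ¬¬-Monad (All.tabulate λ _ → ¬¬-excluded-middle))

lemma5p2 : (L : FiniteGradedLattice) (U : UphoLattice) → CoreIso L U →
    (m : ℕ) → m ≥ 1 → (k : ℕ) →
    + 0 ≤ℤ divSeries (substPow (FiniteGradedLattice.chiStar L) m)
                     (FiniteGradedLattice.chiStar L ^ˢ m) k
lemma5p2 L U iso (suc m) _ k =
  -- The order of U is not decidable in general, but the goal is, so decisions
  -- for the finitely many comparisons needed may be assumed.
  decidable-stable (+ 0 ℤ.≤? _) λ ¬nonneg →
    ¬¬-decide-all W (UphoLattice._≤_ U) λ decisions → ¬nonneg (nonneg decisions)
  where
  W = UphoLattice.coreTop U ∷ levels U k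
  nonneg : All (λ x → All (λ y → Dec (UphoLattice._≤_ U x y)) W) W →
           + 0 ≤ℤ divSeries (substPow (FiniteGradedLattice.chiStar L) (suc m)) (FiniteGradedLattice.chiStar L ^ˢ suc m) k
  nonneg decisions = subst (+ 0 ≤ℤ_) (sym (divSeries≡quotient m)) (quotient-nonneg m)
    where open Truncation L U iso k (truncate U k λ x∈ y∈ → All.lookup (All.lookup decisions x∈) y∈)
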